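{- The family $(\mathfrak{P}_F)_{F\in\mathsf{IndFor}_+}$ is a basis of $\mathbb{Q}[x_1,x_2,\dots]$. More precisely, for every positive integer $n$, the family $\{\mathfrak{P}_F\}$, where $F$ ranges over indexed forests with $\mathrm{LSupp}(F)\subseteq[n]$, is a basis of $\mathbb{Q}[x_1,\dots,x_n]$. Furthermore $$\mathbb{Q}\{\mathfrak{P}_F:\mathrm{Supp}(F)\subseteq[n-1]\}=\mathbb{Q}\{\mathbf x^{\mathbf c}:\mathbf c\in\mathrm{ABB}_n\}.$$
   Context: Indexed forests: for finite $S\subset\mathbb{Z}$ with maximal consecutive blocks $I_1<\cdots<I_k$, an indexed forest $F$ with support $\mathrm{Supp}(F)=S$ is a tuple of plane binary trees $T_j$ with $|I_j|$ nodes, canonically labeled by $I_j$ in inorder (missing children are leaves). $\mathsf{IndFor}_+$ denotes those with $S\subset\mathbb{Z}_{\ge1}$. $\mathrm{LSupp}(F)$ is the set of canonical labels of nodes having no left child. $\rho_F(v)$ is the canonical label of the node reached from $v$ by following left children as long as possible. The forest polynomial is $\mathfrak{P}_F=\sum_\kappa\prod_vx_{\kappa(v)}$ over $\kappa:\operatorname{IN}(F)\to\mathbb{Z}_{\ge1}$ with $\kappa(v)\le\rho_F(v)$, $\kappa(\text{left child of }u)\ge\kappa(u)$, and $\kappa(\text{right child of }u)>\kappa(u)$; the empty forest gives $1$. $\mathrm{ABB}_n$ is the set of $(c_1,\dots,c_n)\in\mathbb{Z}_{\ge0}^n$ with $\sum_{i=1}^jc_{n+1-i}\le j-1$ for $j=1,\dots,n$,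 and $\mathbf x^{\mathbf c}=\prod_ix_i^{c_i}$. -}

module Defs where

open import Data.Bool using (Bool; true; false; if_then_else_; _∧_)
open import Data.Nat as ℕ using (ℕ; zero; suc; _≤_; _<_; _≤ᵇ_; _<ᵇ_; _≡ᵇ_; _⊔_; _∸_)
open import Data.Nat.Properties using () renaming (_≟_ to _≟ℕ_)
open import Data.Maybe using (Maybe; just; nothing)
open import Data.List using (List; []; _∷_; _++_; [_]; map; concatMap; foldr; length; filterᵇ; upTo; take; reverse)
open import Data.List.Properties using (≡-dec)
open import Data.Nat.ListAction using (sum)
open import Data.List.Relation.Unary.All using (All)
open import Data.List.Relation.Unary.Unique.Propositional using (Unique)
open import Data.Vec using (Vec; toList)
open import Data.Product using (_×_; _,_; proj₁; proj₂; Σ)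
open import Data.Rational using (ℚ; 0ℚ; 1ℚ) renaming (_+_ to _+ℚ_; _*_ to _*ℚ_)
open import Relation.Nullary using (does)
open import Relation.Binary.PropositionalEquality using (_≡_; _≢_)

-- Polynomials in Q[x₁, x₂, …]
-- A monomial is its exponent list (e₁, e₂, …) (exponent of x₁ first);
-- trailing zeros are irrelevant.  A polynomial is a finite formal sum
-- of terms (coefficient, monomial), compared via coefficient extraction.

Mon : Set
Mon = List ℕ

normMon : Mon → Mon
normMon [] = []
normMon (e ∷ es) with normMon es
... | [] = if e ≡ᵇ 0 then [] else (e ∷ [])
... | ys@(_ ∷ _) = e ∷ ys

monEq : Mon → Mon → Bool
monEq m m' = does (≡-dec _≟ℕ_ (normMon m) (normMon m'))

Poly : Set
Poly = List (ℚ × Mon)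

coeff : Poly → Mon → ℚ
coeff p m = foldr (λ t acc → if monEq (proj₂ t) m then proj₁ t +ℚ acc else acc) 0ℚ p

_≈ₚ_ : Poly → Poly → Set
p ≈ₚ q = ∀ m → coeff p m ≡ coeff q m

zeroP : Poly
zeroP = []

scaleP : ℚ → Poly → Poly
scaleP c = map (λ t → (c *ℚ proj₁ t , proj₂ t))

InVars : ℕ → Poly → Set
InVars n p = ∀ m → coeff p m ≢ 0ℚ → length (normMon m) ≤ n

linComb : {I : Set} → (I → Poly) → List (ℚ × I) → Poly
linComb f cs = concatMap (λ t → scaleP (proj₁ t) (f (proj₂ t))) cs

InSpan : {I : Set} → (I → Poly) → (I → Set) → Poly → Set
InSpan {I} f Q p = Σ (List (ℚ × I)) λ cs → All (λ t → Q (proj₂ t)) cs × (p ≈ₚ linComb f cs)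

LinIndep : {I : Set} → (I → Poly) → (I → Set) → Set
LinIndep {I} f Q = ∀ (cs : List (ℚ × I)) → All (λ t → Q (proj₂ t)) cs →
  Unique (map proj₂ cs) → linComb f cs ≈ₚ zeroP → All (λ t → proj₁ t ≡ 0ℚ) cs

IsBasisOf : {I : Set} → (I → Poly) → (I → Set) → (Poly → Set) → Set
IsBasisOf {I} f Q V =
  (∀ i → Q i → V (f i)) × (∀ p → V p → InSpan f Q p) × LinIndep f Q

-- Plane binary trees (nodes = internal vertices, leaves = missing children)

data Tree : Set where
  leaf : Tree
  node : Tree → Tree → Tree

size : Tree → ℕ
size leaf = 0
size (node l r) = suc (size l ℕ.+ size r)

-- The maximal blocks
-- I₁ < ⋯ < I_k are encoded by gaps: a block is a nonempty tree
-- (root with subtrees `left`, `right`) and a gap g; the first block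
-- starts at 1 + g, each later block starts at (end of previous) + 2 + g.
-- This is a bijective encoding of IndFor₊.
record Block : Set where
  constructor blk
  field
    gap   : ℕ
    left  : Tree
    right : Tree

blockTree : Block → Tree
blockTree (blk _ l r) = node l r

IndFor₊ : Set
IndFor₊ = List Block

record NodeInfo : Set where
  constructor ninfo
  field
    label : ℕ
    rho   : ℕ
    lch   : Maybe ℕ
    rch   : Maybe ℕ
open NodeInfo public

-- canonical (inorder) label of the root of a subtree whose smallest label is a
rootLabel : Tree → ℕ → Maybe ℕ
rootLabel leaf a = nothing
rootLabel (node l r) a = just (a ℕ.+ size l)

leftmost : Tree → Tree → ℕ → ℕ
leftmost leaf r a = a
leftmost (node ll lr) r a = leftmost ll lr a

treeNodes : Tree → ℕ → List NodeInfo
treeNodes leaf a = []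
treeNodes (node l r) a =
  treeNodes l a ++
  (ninfo (a ℕ.+ size l) (leftmost l r a) (rootLabel l a) (rootLabel r (suc (a ℕ.+ size l))) ∷ [])
  ++ treeNodes r (suc (a ℕ.+ size l))

-- `next` = smallest allowed start of the next block (before adding the gap)
forestNodes' : ℕ → IndFor₊ → List NodeInfo
forestNodes' next [] = []
forestNodes' next (b ∷ bs) =
  let a = next ℕ.+ Block.gap b
      t = blockTree b
  in treeNodes t a ++ forestNodes' (a ℕ.+ size t ℕ.+ 1) bs

forestNodes : IndFor₊ → List NodeInfo
forestNodes = forestNodes' 1

Supp : IndFor₊ → List ℕ
Supp F = map label (forestNodes F)

LSupp : IndFor₊ → List ℕ
LSupp F = map label (filterᵇ (λ v → noLeft (lch v)) (forestNodes F))
  where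
  noLeft : Maybe ℕ → Bool
  noLeft nothing = true
  noLeft (just _) = false

_⊆[_] : List ℕ → ℕ → Set
S ⊆[ n ] = All (λ k → 1 ≤ k × k ≤ n) S

-- all labelings κ (as a list aligned with the node list) with 1 ≤ κ(v) ≤ ρ(v)
assignments : List NodeInfo → List (List ℕ)
assignments [] = [] ∷ []
assignments (v ∷ vs) =
  concatMap (λ k → map (suc k ∷_) (assignments vs)) (upTo (rho v))

kappaAt : List NodeInfo → List ℕ → ℕ → ℕ
kappaAt [] _ _ = 0
kappaAt (_ ∷ _) [] _ = 0
kappaAt (v ∷ vs) (k ∷ ks) i = if label v ≡ᵇ i then k else kappaAt vs ks i

validκ : List NodeInfo → List ℕ → Bool
validκ vs κ = foldr (λ u acc → checkL u ∧ checkR u ∧ acc) true vs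
  where
  checkL : NodeInfo → Bool
  checkL u with lch u
  ... | nothing = true
  ... | just l = kappaAt vs κ (label u) ≤ᵇ kappaAt vs κ l
  checkR : NodeInfo → Bool
  checkR u with rch u
  ... | nothing = true
  ... | just r = kappaAt vs κ (label u) <ᵇ kappaAt vs κ r

count : ℕ → List ℕ → ℕ
count i ks = length (filterᵇ (λ k → k ≡ᵇ i) ks)

monOf : List ℕ → Mon
monOf ks = map (λ i → count (suc i) ks) (upTo (foldr _⊔_ 0 ks))

forestPoly : IndFor₊ → Poly
forestPoly F =
  map (λ κ → (1ℚ , monOf κ)) (filterᵇ (validκ (forestNodes F)) (assignments (forestNodes F)))

ABB : (n : ℕ) → Vec ℕ n → Set
ABB n c = ∀ j → 1 ≤ j → j ≤ n → sum (take j (reverse (toList c))) ≤ j ∸ 1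

monoP : {n : ℕ} → Vec ℕ n → Poly
monoP c = (1ℚ , toList c) ∷ []

-- Every indexed forest F carries the labeling κ = ρ, which dominates every other labeling
-- entrywise; so the monomial x^ρ = ∏_v x_{ρ(v)} occurs in 𝔓_F with coefficient 1, and every
-- other monomial of 𝔓_F has smaller total weight Σ κ. The multiset of ρ-values determines F,
-- and every monomial is x^ρ for some F.
-- Hence the family is unitriangular for the weight Σ ρ: it is independent, and by induction
-- on the weight each monomial x^ρ(F) = 𝔓_F − (lighter monomials) lies in its span. The
-- variable bounds travel along this bijection: LSupp F ⊆ [n] iff all ρ ≤ n (ρ(v) is the label
-- of a node without left child), and Supp F ⊆ [n−1] iff x^ρ is ABB, in which case every
-- labeling κ ≤ ρ ≤ label is ABB as well.

module Submission where

open import Defs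
open import Algebra.Bundles using (CommutativeMonoid)
import Algebra.Properties.CommutativeSemigroup as CommSemigroupProperties
open import Data.Bool using (Bool; true; false; if_then_else_; _∧_; not; T)
open import Data.Bool.Properties using (T-≡)
open import Data.Empty using (⊥-elim)
open import Data.List using (List; []; _∷_; _++_; map; foldr; length; filterᵇ; upTo; concatMap; applyUpTo; take; reverse)
open import Data.List.Properties using (≡-dec)
import Data.List.Properties as LP
open import Data.List.Relation.Unary.All using (All; []; _∷_)
import Data.List.Relation.Unary.All as All
import Data.List.Relation.Unary.All.Properties as AllP
open import Data.List.Relation.Unary.Any using (Any; here; there)
import Data.List.Relation.Unary.Any.Properties as AnyP
open import Data.List.Relation.Unary.AllPairs using (AllPairs; []; _∷_)
import Data.List.Relation.Unary.AllPairs.Properties as AllPairsP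
open import Data.List.Relation.Binary.Pointwise using (Pointwise; []; _∷_)
open import Data.List.Membership.Propositional using (_∈_; find)
import Data.List.Membership.Propositional.Properties as MP
import Data.List.Relation.Binary.Permutation.Propositional.Properties as PermP
open import Data.Maybe using (Maybe; just; nothing)
open import Data.Nat as ℕ using (ℕ; zero; suc; _+_; _*_; _∸_; _≤_; _<_; z≤n; s≤s; _≡ᵇ_; _≤ᵇ_; _<ᵇ_; _⊔_)
import Data.Nat.Properties as NP
open import Data.Nat.ListAction using (sum)
import Data.Nat.ListAction.Properties as SumP
open import Data.Nat.Solver using (module +-*-Solver)
open import Data.Product using (Σ; _×_; _,_; proj₁; proj₂)
open import Data.Rational using (ℚ; 0ℚ; 1ℚ; -_) renaming (_+_ to _+ℚ_; _*_ to _*ℚ_)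
import Data.Rational.Properties as QP
open import Data.Sum using (_⊎_; inj₁; inj₂)
open import Data.Unit using (⊤; tt)
open import Data.Vec using (Vec; toList)
import Data.Vec as Vec
import Data.Vec.Properties as VecP
open import Function using (id; _∘_)
open import Function.Bundles using (_⇔_; mk⇔; Equivalence)
open import Relation.Binary.PropositionalEquality
open import Relation.Binary.Definitions using (DecidableEquality)
open import Relation.Nullary using (yes; no; does)
open import Relation.Nullary.Decidable using (T?; dec-true)

open +-*-Solver using (solve; _:+_; _:*_; _:=_)
open CommSemigroupProperties (CommutativeMonoid.commutativeSemigroup QP.+-0-commutativeMonoid)
  using () renaming (x∙yz≈y∙xz to +ℚ-swapˡ)

-- Index i stands for the variable x_{i+1}.
expAt : Mon → ℕ → ℕ
expAt [] i = 0
expAt (e ∷ es) zero = e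
expAt (e ∷ es) (suc i) = expAt es i

_≋_ : Mon → Mon → Set
m ≋ m' = ∀ i → expAt m i ≡ expAt m' i

expAt-normMon : ∀ m i → expAt (normMon m) i ≡ expAt m i
expAt-normMon [] i = refl
expAt-normMon (e ∷ es) i with normMon es | expAt-normMon es
expAt-normMon (zero ∷ es) zero | [] | _ = refl
expAt-normMon (suc e ∷ es) zero | [] | _ = refl
expAt-normMon (zero ∷ es) (suc i) | [] | ih = ih i
expAt-normMon (suc e ∷ es) (suc i) | [] | ih = ih i
... | _ ∷ _ | ih with i
... | zero = refl
... | suc j = ih j

normMon-zeroes : ∀ m → (∀ i → expAt m i ≡ 0) → normMon m ≡ []
normMon-zeroes [] h = refl
normMon-zeroes (e ∷ es) h with normMon es | normMon-zeroes es (h ∘ suc)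
... | .[] | refl with h zero
... | refl = refl

normMon-cong : ∀ m m' → m ≋ m' → normMon m ≡ normMon m'
normMon-cong [] m' h = sym (normMon-zeroes m' (sym ∘ h))
normMon-cong (e ∷ es) [] h = normMon-zeroes (e ∷ es) h
normMon-cong (e ∷ es) (e' ∷ es') h with h zero
... | refl with normMon es | normMon es' | normMon-cong es es' (h ∘ suc)
... | [] | .[] | refl = refl
... | _ ∷ _ | ._ | refl = refl

monEq⇒≋ : ∀ m m' → monEq m m' ≡ true → m ≋ m'
monEq⇒≋ m m' h i with ≡-dec NP._≟_ (normMon m) (normMon m')
... | yes eq = begin
  expAt m i           ≡⟨ expAt-normMon m i ⟨
  expAt (normMon m) i  ≡⟨ cong (λ z → expAt z i) eq ⟩
  expAt (normMon m') i ≡⟨ expAt-normMon m' i ⟩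
  expAt m' i           ∎
  where open ≡-Reasoning
monEq⇒≋ m m' () i | no _

≋⇒monEq : ∀ m m' → m ≋ m' → monEq m m' ≡ true
≋⇒monEq m m' h = dec-true (≡-dec NP._≟_ (normMon m) (normMon m')) (normMon-cong m m' h)

monEq-congˡ : ∀ m₁ m₂ m → m₁ ≋ m₂ → monEq m₁ m ≡ monEq m₂ m
monEq-congˡ m₁ m₂ m h = cong (λ z → does (≡-dec NP._≟_ z (normMon m))) (normMon-cong m₁ m₂ h)

monEq-congʳ : ∀ m m₁ m₂ → m₁ ≋ m₂ → monEq m m₁ ≡ monEq m m₂
monEq-congʳ m m₁ m₂ h = cong (λ z → does (≡-dec NP._≟_ (normMon m) z)) (normMon-cong m₁ m₂ h)

coeff-++ : ∀ p q m → coeff (p ++ q) m ≡ coeff p m +ℚ coeff q m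
coeff-++ [] q m = sym (QP.+-identityˡ _)
coeff-++ ((c , m₀) ∷ p) q m with monEq m₀ m
... | true = trans (cong (c +ℚ_) (coeff-++ p q m)) (sym (QP.+-assoc c _ _))
... | false = coeff-++ p q m

coeff-scaleP : ∀ c p m → coeff (scaleP c p) m ≡ c *ℚ coeff p m
coeff-scaleP c [] m = sym (QP.*-zeroʳ c)
coeff-scaleP c ((d , m₀) ∷ p) m with monEq m₀ m
... | true = trans (cong ((c *ℚ d) +ℚ_) (coeff-scaleP c p m)) (sym (QP.*-distribˡ-+ c d _))
... | false = coeff-scaleP c p m

coeff-congʳ : ∀ p m m' → m ≋ m' → coeff p m ≡ coeff p m'
coeff-congʳ [] m m' h = refl
coeff-congʳ ((c , m₀) ∷ p) m m' h rewrite monEq-congʳ m₀ m m' h | coeff-congʳ p m m' h = refl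

indicator : Bool → ℚ
indicator true = 1ℚ
indicator false = 0ℚ

coeff-∷ : ∀ c m p m' → coeff ((c , m) ∷ p) m' ≡ c *ℚ indicator (monEq m m') +ℚ coeff p m'
coeff-∷ c m p m' with monEq m m'
... | true = cong (_+ℚ coeff p m') (sym (QP.*-identityʳ c))
... | false = trans (sym (QP.+-identityˡ _)) (cong (_+ℚ coeff p m') (sym (QP.*-zeroʳ c)))

coeff-monomial : ∀ m m' → coeff ((1ℚ , m) ∷ []) m' ≡ indicator (monEq m m')
coeff-monomial m m' with monEq m m'
... | true = QP.+-identityʳ 1ℚ
... | false = refl

module _ {I : Set} (f : I → Poly) where

  linComb-∷ : ∀ c i cs m → coeff (linComb f ((c , i) ∷ cs)) m ≡ c *ℚ coeff (f i) m +ℚ coeff (linComb f cs) m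
  linComb-∷ c i cs m = trans (coeff-++ (scaleP c (f i)) (linComb f cs) m)
    (cong (_+ℚ coeff (linComb f cs) m) (coeff-scaleP c (f i) m))

  linComb-++ : ∀ cs ds m → coeff (linComb f (cs ++ ds)) m ≡ coeff (linComb f cs) m +ℚ coeff (linComb f ds) m
  linComb-++ [] ds m = sym (QP.+-identityˡ _)
  linComb-++ ((c , i) ∷ cs) ds m = begin
    coeff (linComb f ((c , i) ∷ cs ++ ds)) m     ≡⟨ linComb-∷ c i (cs ++ ds) m ⟩
    a +ℚ coeff (linComb f (cs ++ ds)) m          ≡⟨ cong (a +ℚ_) (linComb-++ cs ds m) ⟩
    a +ℚ (coeff (linComb f cs) m +ℚ d)           ≡⟨ QP.+-assoc a _ d ⟨
    a +ℚ coeff (linComb f cs) m +ℚ d             ≡⟨ cong (_+ℚ d) (linComb-∷ c i cs m) ⟨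
    coeff (linComb f ((c , i) ∷ cs)) m +ℚ d      ∎
    where
    open ≡-Reasoning
    a = c *ℚ coeff (f i) m
    d = coeff (linComb f ds) m

  scaleCoeffs : ℚ → List (ℚ × I) → List (ℚ × I)
  scaleCoeffs q = map (λ t → (q *ℚ proj₁ t , proj₂ t))

  linComb-scaleCoeffs : ∀ q cs m → coeff (linComb f (scaleCoeffs q cs)) m ≡ q *ℚ coeff (linComb f cs) m
  linComb-scaleCoeffs q [] m = sym (QP.*-zeroʳ q)
  linComb-scaleCoeffs q ((c , i) ∷ cs) m = begin
    coeff (linComb f (scaleCoeffs q ((c , i) ∷ cs))) m                              ≡⟨ linComb-∷ (q *ℚ c) i (scaleCoeffs q cs) m ⟩
    q *ℚ c *ℚ coeff (f i) m +ℚ coeff (linComb f (scaleCoeffs q cs)) m                ≡⟨ cong₂ _+ℚ_ (QP.*-assoc q c _) (linComb-scaleCoeffs q cs m) ⟩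
    q *ℚ (c *ℚ coeff (f i) m) +ℚ q *ℚ coeff (linComb f cs) m                        ≡⟨ QP.*-distribˡ-+ q _ _ ⟨
    q *ℚ (c *ℚ coeff (f i) m +ℚ coeff (linComb f cs) m)                             ≡⟨ cong (q *ℚ_) (linComb-∷ c i cs m) ⟨
    q *ℚ coeff (linComb f ((c , i) ∷ cs)) m                                          ∎
    where open ≡-Reasoning

  InSpan-resp : ∀ {Q : I → Set} p q → p ≈ₚ q → InSpan f Q q → InSpan f Q p
  InSpan-resp p q p≈q (cs , Qcs , q≈) = cs , Qcs , λ m → trans (p≈q m) (q≈ m)

module _ (h : Mon → Bool) (m : Mon) (h-resp : ∀ m₀ → monEq m₀ m ≡ true → h m₀ ≡ h m) where

  coeff-filter-kept : h m ≡ true → ∀ q → coeff (filterᵇ (h ∘ proj₂) q) m ≡ coeff q m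
  coeff-filter-kept hm [] = refl
  coeff-filter-kept hm ((c , m₀) ∷ q) with h m₀ in hm₀
  ... | true with monEq m₀ m
  ...   | true = cong (c +ℚ_) (coeff-filter-kept hm q)
  ...   | false = coeff-filter-kept hm q
  coeff-filter-kept hm ((c , m₀) ∷ q) | false with monEq m₀ m in e
  ...   | false = coeff-filter-kept hm q
  ...   | true with () ← trans (sym hm₀) (trans (h-resp m₀ e) hm)

  coeff-filter-dropped : h m ≡ false → ∀ q → coeff (filterᵇ (h ∘ proj₂) q) m ≡ 0ℚ
  coeff-filter-dropped hm [] = refl
  coeff-filter-dropped hm ((c , m₀) ∷ q) with h m₀ in hm₀
  ... | false = coeff-filter-dropped hm q
  ... | true with monEq m₀ m in e
  ...   | false = coeff-filter-dropped hm q
  ...   | true with () ← trans (sym hm₀) (trans (h-resp m₀ e) hm)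

nonzeroIn : Poly → Mon → Bool
nonzeroIn p m = not (does (coeff p m QP.≟ 0ℚ))

dropZeroTerms : Poly → Poly
dropZeroTerms p = filterᵇ (nonzeroIn p ∘ proj₂) p

nonzeroIn-resp : ∀ p m m₀ → monEq m₀ m ≡ true → nonzeroIn p m₀ ≡ nonzeroIn p m
nonzeroIn-resp p m m₀ eq = cong (λ z → not (does (z QP.≟ 0ℚ))) (coeff-congʳ p m₀ m (monEq⇒≋ m₀ m eq))

dropZeroTerms-≈ : ∀ p → p ≈ₚ dropZeroTerms p
dropZeroTerms-≈ p m with coeff p m QP.≟ 0ℚ in e
... | yes c≡0 = trans c≡0 (sym (coeff-filter-dropped (nonzeroIn p) m (nonzeroIn-resp p m) (cong (not ∘ does) e) p))
... | no _ = sym (coeff-filter-kept (nonzeroIn p) m (nonzeroIn-resp p m) (cong (not ∘ does) e) p)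

dropZeroTerms-nonzero : ∀ p → All (λ t → coeff p (proj₂ t) ≢ 0ℚ) (dropZeroTerms p)
dropZeroTerms-nonzero p = All.map (λ {t} → nonzero t) (AllP.all-filter (T? ∘ (nonzeroIn p ∘ proj₂)) p)
  where
  nonzero : ∀ t → T (nonzeroIn p (proj₂ t)) → coeff p (proj₂ t) ≢ 0ℚ
  nonzero t keep c≡0 with coeff p (proj₂ t) QP.≟ 0ℚ
  ... | yes _ = keep
  ... | no c≢0 = c≢0 c≡0

δ : ℕ → ℕ → ℕ
δ a i = if a ≡ᵇ i then 1 else 0

δ-diag : ∀ a → δ a a ≡ 1
δ-diag zero = refl
δ-diag (suc a) = δ-diag a

δ-≢ : ∀ a i → a ≢ i → δ a i ≡ 0
δ-≢ a i a≢i with a ≡ᵇ i in e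
... | false = refl
... | true = ⊥-elim (a≢i (NP.≡ᵇ⇒≡ a i (subst T (sym e) tt)))

count-∷ : ∀ i x xs → count i (x ∷ xs) ≡ δ x i + count i xs
count-∷ i x xs with x ≡ᵇ i
... | true = refl
... | false = refl

count-++ : ∀ i xs ys → count i (xs ++ ys) ≡ count i xs + count i ys
count-++ i [] ys = refl
count-++ i (x ∷ xs) ys = begin
  count i (x ∷ xs ++ ys)              ≡⟨ count-∷ i x (xs ++ ys) ⟩
  δ x i + count i (xs ++ ys)          ≡⟨ cong (δ x i +_) (count-++ i xs ys) ⟩
  δ x i + (count i xs + count i ys)   ≡⟨ NP.+-assoc (δ x i) _ _ ⟨
  δ x i + count i xs + count i ys     ≡⟨ cong (_+ count i ys) (count-∷ i x xs) ⟨
  count i (x ∷ xs) + count i ys       ∎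
  where open ≡-Reasoning

count-map-suc : ∀ i xs → count (suc i) (map suc xs) ≡ count i xs
count-map-suc i [] = refl
count-map-suc i (x ∷ xs) = trans (count-∷ (suc i) (suc x) (map suc xs))
  (trans (cong (δ x i +_) (count-map-suc i xs)) (sym (count-∷ i x xs)))

count-zero-pos : ∀ xs → All (1 ≤_) xs → count 0 xs ≡ 0
count-zero-pos [] _ = refl
count-zero-pos (suc x ∷ xs) (_ ∷ pos) = count-zero-pos xs pos

count-all-< : ∀ i xs → All (_< i) xs → count i xs ≡ 0
count-all-< i [] [] = refl
count-all-< i (x ∷ xs) (x<i ∷ xs<i) = trans (count-∷ i x xs)
  (cong₂ _+_ (δ-≢ x i (λ x≡i → NP.<-irrefl x≡i x<i)) (count-all-< i xs xs<i))

count-middle : ∀ a xs ys → 0 < count a (xs ++ a ∷ ys)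
count-middle a xs ys rewrite count-++ a xs (a ∷ ys) | count-∷ a a ys | δ-diag a =
  NP.<-≤-trans (s≤s z≤n) (NP.m≤n+m (suc (count a ys)) (count a xs))

count-upTo : ∀ r y → y < r → count y (upTo r) ≡ 1
count-upTo (suc r) y y<r rewrite sym (LP.map-applyUpTo id suc r) with y | y<r
... | zero | _ = cong suc (count-zero-pos (map suc (upTo r)) (AllP.map⁺ (All.universal (λ _ → s≤s z≤n) (upTo r))))
... | suc y | s≤s y<r = trans (count-map-suc y (upTo r)) (count-upTo r y y<r)

count-above⇒all≤ : ∀ xs n → All (1 ≤_) xs → (∀ i → n ≤ i → count (suc i) xs ≡ 0) → All (_≤ n) xs
count-above⇒all≤ [] n _ _ = []
count-above⇒all≤ (suc x ∷ xs) n (_ ∷ pos) none = x<n ∷ count-above⇒all≤ xs n pos none-xs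
  where
  none-xs : ∀ i → n ≤ i → count (suc i) xs ≡ 0
  none-xs i n≤i = NP.m+n≡0⇒n≡0 (δ (suc x) (suc i)) (trans (sym (count-∷ (suc i) (suc x) xs)) (none i n≤i))
  x<n : suc x ≤ n
  x<n with x ℕ.<? n
  ... | yes x<n = x<n
  ... | no x≮n with () ← trans (sym (δ-diag x))
          (NP.m+n≡0⇒m≡0 (δ (suc x) (suc x)) (trans (sym (count-∷ (suc x) (suc x) xs)) (none x (NP.≮⇒≥ x≮n))))

all-≤-sum : ∀ xs → All (_≤ sum xs) xs
all-≤-sum [] = []
all-≤-sum (x ∷ xs) = NP.m≤m+n x _ ∷ All.map (λ p → NP.≤-trans p (NP.m≤n+m _ x)) (all-≤-sum xs)

sumRange : (ℕ → ℕ) → ℕ → ℕ → ℕ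
sumRange f t zero = 0
sumRange f t (suc k) = f t + sumRange f (suc t) k

sumRange-cong : ∀ {f g} t k → (∀ i → f i ≡ g i) → sumRange f t k ≡ sumRange g t k
sumRange-cong t zero f≗g = refl
sumRange-cong t (suc k) f≗g = cong₂ _+_ (f≗g t) (sumRange-cong (suc t) k f≗g)

sumRange-+ : ∀ f g t k → sumRange (λ i → f i + g i) t k ≡ sumRange f t k + sumRange g t k
sumRange-+ f g t zero = refl
sumRange-+ f g t (suc k) = trans (cong (f t + g t +_) (sumRange-+ f g (suc t) k))
  (swap (f t) (g t) (sumRange f (suc t) k) (sumRange g (suc t) k))
  where
  swap : ∀ a b c d → a + b + (c + d) ≡ a + c + (b + d)
  swap = solve 4 (λ a b c d → a :+ b :+ (c :+ d) := a :+ c :+ (b :+ d)) refl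

sumRange-zero : ∀ t k → sumRange (λ _ → 0) t k ≡ 0
sumRange-zero t zero = refl
sumRange-zero t (suc k) = sumRange-zero (suc t) k

sumRange-δ-below : ∀ (f : ℕ → ℕ) x t k → x < t → sumRange (λ i → f i * δ x i) t k ≡ 0
sumRange-δ-below f x t zero x<t = refl
sumRange-δ-below f x t (suc k) x<t = begin
  f t * δ x t + rest   ≡⟨ cong (λ d → f t * d + rest) (δ-≢ x t (NP.<⇒≢ x<t)) ⟩
  f t * 0 + rest       ≡⟨ cong₂ _+_ (NP.*-zeroʳ (f t)) (sumRange-δ-below f x (suc t) k (NP.m<n⇒m<1+n x<t)) ⟩
  0                    ∎
  where
  open ≡-Reasoning
  rest = sumRange (λ i → f i * δ x i) (suc t) k

sumRange-δ-inside : ∀ (f : ℕ → ℕ) x t k → t ≤ x → x < t + k → sumRange (λ i → f i * δ x i) t k ≡ f x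
sumRange-δ-inside f x t zero t≤x x<t+0 = ⊥-elim (NP.<⇒≱ (subst (x <_) (NP.+-identityʳ t) x<t+0) t≤x)
sumRange-δ-inside f x t (suc k) t≤x x<t+k with NP.m≤n⇒m<n∨m≡n t≤x
... | inj₂ refl = begin
  f x * δ x x + rest   ≡⟨ cong₂ _+_ (cong (f x *_) (δ-diag x)) (sumRange-δ-below f x (suc x) k NP.≤-refl) ⟩
  f x * 1 + 0          ≡⟨ trans (NP.+-identityʳ _) (NP.*-identityʳ (f x)) ⟩
  f x                  ∎
  where
  open ≡-Reasoning
  rest = sumRange (λ i → f i * δ x i) (suc x) k
... | inj₁ t<x = begin
  f t * δ x t + rest   ≡⟨ cong (λ d → f t * d + rest) (δ-≢ x t (NP.>⇒≢ t<x)) ⟩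
  f t * 0 + rest       ≡⟨ cong₂ _+_ (NP.*-zeroʳ (f t)) (sumRange-δ-inside f x (suc t) k t<x (subst (x <_) (NP.+-suc t k) x<t+k)) ⟩
  f x                  ∎
  where
  open ≡-Reasoning
  rest = sumRange (λ i → f i * δ x i) (suc t) k

sum≡weightedCounts : ∀ B xs → All (_< B) xs → sum xs ≡ sumRange (λ i → i * count i xs) 0 B
sum≡weightedCounts B [] [] = sym (trans (sumRange-cong 0 B NP.*-zeroʳ) (sumRange-zero 0 B))
sum≡weightedCounts B (x ∷ xs) (x<B ∷ xs<B) = sym (begin
  sumRange (λ i → i * count i (x ∷ xs)) 0 B                      ≡⟨ sumRange-cong 0 B (λ i → trans (cong (i *_) (count-∷ i x xs)) (NP.*-distribˡ-+ i (δ x i) _)) ⟩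
  sumRange (λ i → i * δ x i + i * count i xs) 0 B                ≡⟨ sumRange-+ _ _ 0 B ⟩
  sumRange (λ i → i * δ x i) 0 B + sumRange (λ i → i * count i xs) 0 B ≡⟨ cong₂ _+_ (sumRange-δ-inside (λ i → i) x 0 B z≤n x<B) (sym (sum≡weightedCounts B xs xs<B)) ⟩
  x + sum xs                                                     ∎)
  where open ≡-Reasoning

sum-cong-counts : ∀ xs ys → All (1 ≤_) xs → All (1 ≤_) ys → (∀ i → count (suc i) xs ≡ count (suc i) ys) → sum xs ≡ sum ys
sum-cong-counts xs ys xs-pos ys-pos same = begin
  sum xs                                   ≡⟨ sum≡weightedCounts B xs (All.map (λ p → s≤s (NP.≤-trans p (NP.m≤m+n _ _))) (all-≤-sum xs)) ⟩
  sumRange (λ i → i * count i xs) 0 B      ≡⟨ sumRange-cong 0 B (λ i → cong (i *_) (same′ i)) ⟩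
  sumRange (λ i → i * count i ys) 0 B      ≡⟨ sum≡weightedCounts B ys (All.map (λ p → s≤s (NP.≤-trans p (NP.m≤n+m _ (sum xs)))) (all-≤-sum ys)) ⟨
  sum ys                                   ∎
  where
  open ≡-Reasoning
  B = suc (sum xs + sum ys)
  same′ : ∀ i → count i xs ≡ count i ys
  same′ zero = trans (count-zero-pos xs xs-pos) (sym (count-zero-pos ys ys-pos))
  same′ (suc i) = same i

countAbove : ℕ → List ℕ → ℕ
countAbove t xs = length (filterᵇ (t <ᵇ_) xs)

isAbove : ℕ → ℕ → ℕ
isAbove t x = if t <ᵇ x then 1 else 0

countAbove-∷ : ∀ t x xs → countAbove t (x ∷ xs) ≡ isAbove t x + countAbove t xs
countAbove-∷ t x xs with t <ᵇ x
... | true = refl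
... | false = refl

sumRange-δ-suc : ∀ x t k → x ≤ t + k → sumRange (λ i → δ x (suc i)) t k ≡ isAbove t x
sumRange-δ-suc x t k x≤t+k with t <ᵇ x in e
sumRange-δ-suc (suc x) t k x<t+k | true = begin
  sumRange (δ x) t k                       ≡⟨ sumRange-cong t k (λ i → NP.*-identityˡ (δ x i)) ⟨
  sumRange (λ i → 1 * δ x i) t k           ≡⟨ sumRange-δ-inside (λ _ → 1) x t k (NP.≤-pred (NP.<ᵇ⇒< t (suc x) (subst T (sym e) tt))) x<t+k ⟩
  1                                        ∎
  where open ≡-Reasoning
sumRange-δ-suc zero t k _ | false = sumRange-zero t k
sumRange-δ-suc (suc x) t k _ | false =
  trans (sumRange-cong t k (λ i → sym (NP.*-identityˡ (δ x i))))
        (sumRange-δ-below (λ _ → 1) x t k (NP.≮⇒≥ (λ t<1+x → subst T e (NP.<⇒<ᵇ t<1+x))))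

sumRange-count : ∀ xs t k → All (_≤ t + k) xs → sumRange (λ i → count (suc i) xs) t k ≡ countAbove t xs
sumRange-count [] t k [] = sumRange-zero t k
sumRange-count (x ∷ xs) t k (x≤ ∷ xs≤) = begin
  sumRange (λ i → count (suc i) (x ∷ xs)) t k                          ≡⟨ sumRange-cong t k (λ i → count-∷ (suc i) x xs) ⟩
  sumRange (λ i → δ x (suc i) + count (suc i) xs) t k                  ≡⟨ sumRange-+ _ _ t k ⟩
  sumRange (λ i → δ x (suc i)) t k + sumRange (λ i → count (suc i) xs) t k ≡⟨ cong₂ _+_ (sumRange-δ-suc x t k x≤) (sumRange-count xs t k xs≤) ⟩
  isAbove t x + countAbove t xs                                          ≡⟨ countAbove-∷ t x xs ⟨
  countAbove t (x ∷ xs)                                                 ∎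
  where open ≡-Reasoning

-- The ρ-values of a forest

rhos : List NodeInfo → List ℕ
rhos = map rho

rhosF : IndFor₊ → List ℕ
rhosF F = rhos (forestNodes F)

leftmost≡start : ∀ l r a → leftmost l r a ≡ a
leftmost≡start leaf r a = refl
leftmost≡start (node l l') r a = leftmost≡start l l' a

rhos-++ : ∀ vs ws → rhos (vs ++ ws) ≡ rhos vs ++ rhos ws
rhos-++ = LP.map-++ rho

rhos-node : ∀ l r a → rhos (treeNodes (node l r) a) ≡ rhos (treeNodes l a) ++ a ∷ rhos (treeNodes r (suc (a + size l)))
rhos-node l r a = trans (rhos-++ (treeNodes l a) _)
  (cong (λ x → rhos (treeNodes l a) ++ x ∷ rhos (treeNodes r (suc (a + size l)))) (leftmost≡start l r a))

rhos-tree-suc : ∀ T a → rhos (treeNodes T (suc a)) ≡ map suc (rhos (treeNodes T a))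
rhos-tree-suc leaf a = refl
rhos-tree-suc (node l r) a = begin
  rhos (treeNodes (node l r) (suc a))                                  ≡⟨ rhos-node l r (suc a) ⟩
  rhos (treeNodes l (suc a)) ++ suc a ∷ rhos (treeNodes r (suc c))     ≡⟨ cong₂ (λ xs ys → xs ++ suc a ∷ ys) (rhos-tree-suc l a) (rhos-tree-suc r c) ⟩
  map suc (rhos (treeNodes l a)) ++ map suc (a ∷ rhos (treeNodes r c)) ≡⟨ LP.map-++ suc (rhos (treeNodes l a)) _ ⟨
  map suc (rhos (treeNodes l a) ++ a ∷ rhos (treeNodes r c))           ≡⟨ cong (map suc) (rhos-node l r a) ⟨
  map suc (rhos (treeNodes (node l r) a))                              ∎
  where
  open ≡-Reasoning
  c = suc (a + size l)

rhos-forest-suc : ∀ F next → rhos (forestNodes' (suc next) F) ≡ map suc (rhos (forestNodes' next F))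
rhos-forest-suc [] next = refl
rhos-forest-suc (blk g l r ∷ bs) next = begin
  rhos (treeNodes t (suc a) ++ forestNodes' (suc a + size t + 1) bs)  ≡⟨ rhos-++ (treeNodes t (suc a)) _ ⟩
  rhos (treeNodes t (suc a)) ++ rhos (forestNodes' (suc (a + size t + 1)) bs)
    ≡⟨ cong₂ _++_ (rhos-tree-suc t a) (rhos-forest-suc bs (a + size t + 1)) ⟩
  map suc (rhos (treeNodes t a)) ++ map suc (rhos (forestNodes' (a + size t + 1) bs))
    ≡⟨ LP.map-++ suc (rhos (treeNodes t a)) _ ⟨
  map suc (rhos (treeNodes t a) ++ rhos (forestNodes' (a + size t + 1) bs))
    ≡⟨ cong (map suc) (rhos-++ (treeNodes t a) _) ⟨
  map suc (rhos (treeNodes t a ++ forestNodes' (a + size t + 1) bs))  ∎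
  where
  open ≡-Reasoning
  t = node l r
  a = next + g

rhos-tree-≥ : ∀ T a → All (a ≤_) (rhos (treeNodes T a))
rhos-tree-≥ leaf a = []
rhos-tree-≥ (node l r) a rewrite rhos-node l r a =
  AllP.++⁺ (rhos-tree-≥ l a) (NP.≤-refl ∷ All.map (NP.≤-trans (NP.m≤n⇒m≤1+n (NP.m≤m+n a (size l)))) (rhos-tree-≥ r _))

rhos-forest-≥ : ∀ F next → All (next ≤_) (rhos (forestNodes' next F))
rhos-forest-≥ [] next = []
rhos-forest-≥ (blk g l r ∷ bs) next rewrite rhos-++ (treeNodes (node l r) (next + g)) (forestNodes' (next + g + size (node l r) + 1) bs) =
  AllP.++⁺ (All.map (NP.≤-trans (NP.m≤m+n next g)) (rhos-tree-≥ (node l r) (next + g)))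
    (All.map (NP.≤-trans next≤) (rhos-forest-≥ bs _))
  where
  next≤ : next ≤ next + g + size (node l r) + 1
  next≤ = NP.≤-trans (NP.m≤m+n next g) (NP.≤-trans (NP.m≤m+n _ (size (node l r))) (NP.m≤m+n _ 1))

rhosF-pos : ∀ F → All (1 ≤_) (rhosF F)
rhosF-pos F = rhos-forest-≥ F 1

-- Decoding monomials into forests

-- A forest seen from a position c: the tree occupying c (leaf if c is a gap), and the forest after it.
splitHead : IndFor₊ → Tree × IndFor₊
splitHead [] = leaf , []
splitHead (blk zero l r ∷ bs) = node l r , bs
splitHead (blk (suc g) l r ∷ bs) = leaf , blk g l r ∷ bs

joinHead : Tree → IndFor₊ → IndFor₊
joinHead leaf [] = []
joinHead leaf (blk g l r ∷ bs) = blk (suc g) l r ∷ bs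
joinHead (node l r) F = blk 0 l r ∷ F

splitHead∘joinHead : ∀ t F → splitHead (joinHead t F) ≡ (t , F)
splitHead∘joinHead leaf [] = refl
splitHead∘joinHead leaf (blk g l r ∷ bs) = refl
splitHead∘joinHead (node l r) F = refl

splitHead-nodes : ∀ F c → let (t , F′) = splitHead F in
  treeNodes t c ++ forestNodes' (c + size t + 1) F′ ≡ forestNodes' c F
splitHead-nodes [] c = refl
splitHead-nodes (blk zero l r ∷ bs) c =
  cong (λ a → treeNodes (node l r) a ++ forestNodes' (a + size (node l r) + 1) bs) (sym (NP.+-identityʳ c))
splitHead-nodes (blk (suc g) l r ∷ bs) c =
  cong (λ a → treeNodes (node l r) a ++ forestNodes' (a + size (node l r) + 1) bs)
    (trans (cong (λ z → z + 1 + g) (NP.+-identityʳ c)) (NP.+-assoc c 1 g))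

-- build j l r F places node l r at the first position and then, j times, makes the current
-- tree the left subtree of a new root whose right subtree is the tree following it.
build : ℕ → Tree → Tree → IndFor₊ → IndFor₊
build zero l r F = blk 0 l r ∷ F
build (suc j) l r F = let (t , F′) = splitHead F in build j (node l r) t F′

-- prepend k F shifts F one step to the right and adds k nodes with ρ = 1 (a left spine starting at 1).
prepend : ℕ → IndFor₊ → IndFor₊
prepend zero [] = []
prepend zero (blk g l r ∷ bs) = blk (suc g) l r ∷ bs
prepend (suc k) F = let (t , F′) = splitHead F in build k leaf t F′

decode : Mon → IndFor₊
decode [] = []
decode (k ∷ m) = prepend k (decode m)

countRho : ℕ → List NodeInfo → ℕ
countRho i vs = count i (rhos vs)

countRho-++ : ∀ i vs ws → countRho i (vs ++ ws) ≡ countRho i vs + countRho i ws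
countRho-++ i vs ws = trans (cong (count i) (rhos-++ vs ws)) (count-++ i (rhos vs) (rhos ws))

countRho-build : ∀ j l r F p i → countRho i (forestNodes' p (build j l r F)) ≡
  countRho i (treeNodes (node l r) p) + j * δ p i + countRho i (forestNodes' (p + size (node l r) + 1) F)
countRho-build zero l r F p i rewrite NP.+-identityʳ p =
  trans (countRho-++ i (treeNodes (node l r) p) _) (cong (_+ countRho i (forestNodes' (p + size (node l r) + 1) F)) (sym (NP.+-identityʳ _)))
countRho-build (suc j) l r F p i = begin
  countRho i (forestNodes' p (build j (node l r) t F′))
    ≡⟨ countRho-build j (node l r) t F′ p i ⟩
  countRho i (treeNodes (node (node l r) t) p) + j * δ p i + countRho i (forestNodes' (p + size (node (node l r) t) + 1) F′)
    ≡⟨ cong₂ (λ x y → x + j * δ p i + countRho i (forestNodes' (y + 1) F′)) spine size-spine ⟩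
  A + (δ p i + B) + j * δ p i + C
    ≡⟨ regroup A (δ p i) B j C ⟩
  A + (δ p i + j * δ p i) + (B + C)
    ≡⟨ cong (A + (δ p i + j * δ p i) +_) rest ⟩
  A + suc j * δ p i + countRho i (forestNodes' (p + s + 1) F) ∎
  where
  open ≡-Reasoning
  t = proj₁ (splitHead F)
  F′ = proj₂ (splitHead F)
  s = size (node l r)
  c = suc (p + s)
  A = countRho i (treeNodes (node l r) p)
  B = countRho i (treeNodes t c)
  C = countRho i (forestNodes' (c + size t + 1) F′)
  regroup : ∀ a d b j e → a + (d + b) + j * d + e ≡ a + (d + j * d) + (b + e)
  regroup = solve 5 (λ a d b j e → a :+ (d :+ b) :+ j :* d :+ e := a :+ (d :+ j :* d) :+ (b :+ e)) refl
  spine : countRho i (treeNodes (node (node l r) t) p) ≡ A + (δ p i + B)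
  spine = trans (cong (count i) (rhos-node (node l r) t p))
    (trans (count-++ i (rhos (treeNodes (node l r) p)) _) (cong (A +_) (count-∷ i p _)))
  size-spine : p + size (node (node l r) t) ≡ c + size t
  size-spine = trans (NP.+-suc p (s + size t)) (cong suc (sym (NP.+-assoc p s (size t))))
  rest : B + C ≡ countRho i (forestNodes' (p + s + 1) F)
  rest = trans (sym (countRho-++ i (treeNodes t c) _))
    (trans (cong (countRho i) (splitHead-nodes F c)) (cong (λ z → countRho i (forestNodes' z F)) (NP.+-comm 1 (p + s))))

count-prepend : ∀ k F i → count i (rhosF (prepend k F)) ≡ k * δ 1 i + count i (map suc (rhosF F))
count-prepend zero [] i = refl
count-prepend zero (blk g l r ∷ bs) i = cong (count i) (rhos-forest-suc (blk g l r ∷ bs) 1)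
count-prepend (suc k) F i = begin
  countRho i (forestNodes' 1 (build k leaf t F′))             ≡⟨ countRho-build k leaf t F′ 1 i ⟩
  countRho i (treeNodes (node leaf t) 1) + k * δ 1 i + C    ≡⟨ cong (λ z → z + k * δ 1 i + C) (count-∷ i 1 (rhos (treeNodes t 2))) ⟩
  δ 1 i + B + k * δ 1 i + C                                  ≡⟨ regroup (δ 1 i) B k C ⟩
  (δ 1 i + k * δ 1 i) + (B + C)                              ≡⟨ cong ((δ 1 i + k * δ 1 i) +_) rest ⟩
  suc k * δ 1 i + count i (map suc (rhosF F))                ∎
  where
  open ≡-Reasoning
  t = proj₁ (splitHead F)
  F′ = proj₂ (splitHead F)
  B = countRho i (treeNodes t 2)
  C = countRho i (forestNodes' (2 + size t + 1) F′)
  regroup : ∀ d b k e → d + b + k * d + e ≡ (d + k * d) + (b + e)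
  regroup = solve 4 (λ d b k e → d :+ b :+ k :* d :+ e := (d :+ k :* d) :+ (b :+ e)) refl
  rest : B + C ≡ count i (map suc (rhosF F))
  rest = trans (sym (countRho-++ i (treeNodes t 2) _))
    (trans (cong (countRho i) (splitHead-nodes F 2)) (cong (count i) (rhos-forest-suc F 1)))

count-one-prepend : ∀ k F → count 1 (rhosF (prepend k F)) ≡ k
count-one-prepend k F = begin
  count 1 (rhosF (prepend k F))              ≡⟨ count-prepend k F 1 ⟩
  k * 1 + count 1 (map suc (rhosF F))        ≡⟨ cong₂ _+_ (NP.*-identityʳ k) (count-map-suc 0 (rhosF F)) ⟩
  k + count 0 (rhosF F)                      ≡⟨ cong (k +_) (count-zero-pos _ (rhosF-pos F)) ⟩
  k + 0                                      ≡⟨ NP.+-identityʳ k ⟩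
  k                                          ∎
  where open ≡-Reasoning

count-suc-suc-prepend : ∀ k F i → count (suc (suc i)) (rhosF (prepend k F)) ≡ count (suc i) (rhosF F)
count-suc-suc-prepend k F i = begin
  count (suc (suc i)) (rhosF (prepend k F))              ≡⟨ count-prepend k F (suc (suc i)) ⟩
  k * 0 + count (suc (suc i)) (map suc (rhosF F))        ≡⟨ cong₂ _+_ (NP.*-zeroʳ k) (count-map-suc (suc i) (rhosF F)) ⟩
  count (suc i) (rhosF F)                                ∎
  where open ≡-Reasoning

count-rhos-decode : ∀ m i → count (suc i) (rhosF (decode m)) ≡ expAt m i
count-rhos-decode [] i = refl
count-rhos-decode (k ∷ m) zero = count-one-prepend k (decode m)
count-rhos-decode (k ∷ m) (suc i) = trans (count-suc-suc-prepend k (decode m) i) (count-rhos-decode m i)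

build-surjective : ∀ j l r F → Σ ℕ λ k → Σ IndFor₊ λ F′ → prepend (suc k) F′ ≡ build j l r F
build-surjective j leaf r F = j , joinHead r F , cong (λ (t , F′) → build j leaf t F′) (splitHead∘joinHead r F)
build-surjective j (node ll lr) r F with build-surjective (suc j) ll lr (joinHead r F)
... | k , F′ , eq = k , F′ , trans eq (cong (λ (t , F″) → build j (node ll lr) t F″) (splitHead∘joinHead r F))

prepend-surjective : ∀ F → Σ ℕ λ k → Σ IndFor₊ λ F′ → prepend k F′ ≡ F
prepend-surjective [] = 0 , [] , refl
prepend-surjective (blk (suc g) l r ∷ bs) = 0 , blk g l r ∷ bs , refl
prepend-surjective (blk zero l r ∷ bs) with build-surjective 0 l r bs
... | k , F′ , eq = suc k , F′ , eq

count-gap : ∀ g l r bs → 0 < count (suc g) (rhosF (blk g l r ∷ bs))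
count-gap g l r bs rewrite rhos-++ (treeNodes (node l r) (suc g)) (forestNodes' (suc g + size (node l r) + 1) bs)
  | count-++ (suc g) (rhos (treeNodes (node l r) (suc g))) (rhos (forestNodes' (suc g + size (node l r) + 1) bs))
  | rhos-node l r (suc g) =
  NP.<-≤-trans (count-middle (suc g) (rhos (treeNodes l (suc g))) _) (NP.m≤m+n _ _)

SameRhos : IndFor₊ → IndFor₊ → Set
SameRhos F G = ∀ i → count (suc i) (rhosF F) ≡ count (suc i) (rhosF G)

noRhos⇒[] : ∀ F → (∀ i → count (suc i) (rhosF F) ≡ 0) → F ≡ []
noRhos⇒[] [] none = refl
noRhos⇒[] (blk g l r ∷ bs) none = ⊥-elim (NP.<-irrefl (sym (none g)) (count-gap g l r bs))

rhos-injective-bounded : ∀ N F G → SameRhos F G → (∀ i → N ≤ i → count (suc i) (rhosF F) ≡ 0) → F ≡ G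
rhos-injective-bounded zero F G same bound =
  trans (noRhos⇒[] F (λ i → bound i z≤n)) (sym (noRhos⇒[] G (λ i → trans (sym (same i)) (bound i z≤n))))
rhos-injective-bounded (suc N) F G same bound with prepend-surjective F | prepend-surjective G
... | k , F′ , refl | k′ , G′ , refl = cong₂ prepend k≡k′ F′≡G′
  where
  k≡k′ : k ≡ k′
  k≡k′ = trans (sym (count-one-prepend k F′)) (trans (same 0) (count-one-prepend k′ G′))
  F′≡G′ : F′ ≡ G′
  F′≡G′ = rhos-injective-bounded N F′ G′
    (λ i → trans (sym (count-suc-suc-prepend k F′ i)) (trans (same (suc i)) (count-suc-suc-prepend k′ G′ i)))
    (λ i N≤i → trans (sym (count-suc-suc-prepend k F′ i)) (bound (suc i) (s≤s N≤i)))

rhos-injective : ∀ F G → SameRhos F G → F ≡ G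
rhos-injective F G same = rhos-injective-bounded (sum (rhosF F)) F G same
  (λ i N≤i → count-all-< (suc i) (rhosF F) (All.map (λ p → s≤s (NP.≤-trans p N≤i)) (all-≤-sum (rhosF F))))

-- ρ is a labeling

_<ₗ_ : NodeInfo → NodeInfo → Set
u <ₗ v = label u < label v

tree-labels : ∀ T a → All (λ v → a ≤ label v × label v < a + size T) (treeNodes T a) × AllPairs _<ₗ_ (treeNodes T a)
tree-labels leaf a = [] , []
tree-labels (node l r) a =
  AllP.++⁺ inL (root-bounds ∷ inR) , AllPairsP.++⁺ sortedL (AllP.++⁺ [] (All.map proj₁ boundsR) ∷ sortedR) L<R
  where
  c = suc (a + size l)
  boundsL = proj₁ (tree-labels l a)
  sortedL = proj₂ (tree-labels l a)
  boundsR = proj₁ (tree-labels r c)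
  sortedR = proj₂ (tree-labels r c)
  end : c + size r ≡ a + size (node l r)
  end = trans (cong suc (NP.+-assoc a (size l) (size r))) (sym (NP.+-suc a _))
  c≤end : a + size l ≤ a + size (node l r)
  c≤end = NP.+-monoʳ-≤ a (NP.m≤n⇒m≤1+n (NP.m≤m+n (size l) (size r)))
  inL = All.map (λ (p , q) → p , NP.<-≤-trans q c≤end) boundsL
  root-bounds : a ≤ a + size l × a + size l < a + size (node l r)
  root-bounds = NP.m≤m+n a (size l) , subst (a + size l <_) end (NP.m≤m+n c (size r))
  inR = All.map (λ {v} (p , q) → NP.≤-trans (NP.m≤m+n a (size l)) (NP.≤-trans (NP.n≤1+n _) p) , subst (label v <_) end q) boundsR
  L<R : All (λ x → All (x <ₗ_) (ninfo (a + size l) (leftmost l r a) (rootLabel l a) (rootLabel r c) ∷ treeNodes r c)) (treeNodes l a)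
  L<R = All.map (λ (_ , q) → q ∷ All.map (λ (p′ , _) → NP.<-≤-trans q (NP.≤-trans (NP.n≤1+n _) p′)) boundsR) boundsL

forest-labels : ∀ F next → All (λ v → next ≤ label v) (forestNodes' next F) × AllPairs _<ₗ_ (forestNodes' next F)
forest-labels [] next = [] , []
forest-labels (blk g l r ∷ bs) next =
  AllP.++⁺ (All.map (λ (p , _) → NP.≤-trans (NP.m≤m+n next g) p) boundsT) (All.map (NP.≤-trans next≤) boundsF) ,
  AllPairsP.++⁺ sortedT sortedF (All.map (λ (_ , q) → All.map (λ p′ → NP.<-≤-trans q (NP.≤-trans (NP.m≤m+n _ 1) p′)) boundsF) boundsT)
  where
  a = next + g
  t = node l r
  boundsT = proj₁ (tree-labels t a)
  sortedT = proj₂ (tree-labels t a)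
  boundsF = proj₁ (forest-labels bs (a + size t + 1))
  sortedF = proj₂ (forest-labels bs (a + size t + 1))
  next≤ : next ≤ a + size t + 1
  next≤ = NP.≤-trans (NP.m≤m+n next g) (NP.≤-trans (NP.m≤m+n a (size t)) (NP.m≤m+n _ 1))

forestNodes-sorted : ∀ F → AllPairs _<ₗ_ (forestNodes F)
forestNodes-sorted F = proj₂ (forest-labels F 1)

-- The conditions that κ = ρ has to satisfy at the children of u.
record ChildRhos (vs : List NodeInfo) (u : NodeInfo) : Set where
  constructor childRhos
  field
    leftRho : ∀ l → lch u ≡ just l → Any (λ v → label v ≡ l × rho v ≡ rho u) vs
    rightRho : ∀ r → rch u ≡ just r → Any (λ v → label v ≡ r × rho u < rho v) vs

ChildRhos-++ˡ : ∀ {vs} ws {u} → ChildRhos vs u → ChildRhos (vs ++ ws) u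
ChildRhos-++ˡ ws (childRhos L R) = childRhos (λ l e → AnyP.++⁺ˡ (L l e)) (λ r e → AnyP.++⁺ˡ (R r e))

ChildRhos-++ʳ : ∀ vs {ws u} → ChildRhos ws u → ChildRhos (vs ++ ws) u
ChildRhos-++ʳ vs (childRhos L R) = childRhos (λ l e → AnyP.++⁺ʳ vs (L l e)) (λ r e → AnyP.++⁺ʳ vs (R r e))

leftChild-rho : ∀ l r a ws x → rootLabel l a ≡ just x →
  Any (λ v → label v ≡ x × rho v ≡ leftmost l r a) (treeNodes l a ++ ws)
leftChild-rho (node ll lr) r a ws x refl = AnyP.++⁺ˡ (AnyP.++⁺ʳ (treeNodes ll a) (here (refl , refl)))

rightChild-rho : ∀ l r a x → rootLabel r (suc (a + size l)) ≡ just x →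
  Any (λ v → label v ≡ x × leftmost l r a < rho v) (treeNodes r (suc (a + size l)))
rightChild-rho l (node rl rr) a x refl = AnyP.++⁺ʳ (treeNodes rl c) (here (refl , ρ<))
  where
  c = suc (a + size l)
  ρ< : leftmost l (node rl rr) a < leftmost rl rr c
  ρ< rewrite leftmost≡start l (node rl rr) a | leftmost≡start rl rr c = s≤s (NP.m≤m+n a (size l))

tree-childRhos : ∀ T a → All (ChildRhos (treeNodes T a)) (treeNodes T a)
tree-childRhos leaf a = []
tree-childRhos (node l r) a =
  AllP.++⁺ (All.map (ChildRhos-++ˡ (root ∷ treeNodes r c)) (tree-childRhos l a))
    (childRhos (leftChild-rho l r a (root ∷ treeNodes r c)) (λ x e → AnyP.++⁺ʳ (treeNodes l a) (there (rightChild-rho l r a x e)))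
     ∷ All.map (ChildRhos-++ʳ (treeNodes l a) ∘ ChildRhos-++ʳ (root ∷ [])) (tree-childRhos r c))
  where
  c = suc (a + size l)
  root = ninfo (a + size l) (leftmost l r a) (rootLabel l a) (rootLabel r c)

forest-childRhos : ∀ F next → All (ChildRhos (forestNodes' next F)) (forestNodes' next F)
forest-childRhos [] next = []
forest-childRhos (blk g l r ∷ bs) next =
  AllP.++⁺ (All.map (ChildRhos-++ˡ (forestNodes' (next + g + size (node l r) + 1) bs)) (tree-childRhos (node l r) (next + g)))
    (All.map (ChildRhos-++ʳ (treeNodes (node l r) (next + g))) (forest-childRhos bs _))

≡ᵇ-refl : ∀ n → (n ≡ᵇ n) ≡ true
≡ᵇ-refl zero = refl
≡ᵇ-refl (suc n) = ≡ᵇ-refl n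

<⇒≡ᵇ-false : ∀ m n → m < n → (m ≡ᵇ n) ≡ false
<⇒≡ᵇ-false zero (suc n) _ = refl
<⇒≡ᵇ-false (suc m) (suc n) (s≤s m<n) = <⇒≡ᵇ-false m n m<n

kappaAt-rhos : ∀ {vs v} → AllPairs _<ₗ_ vs → v ∈ vs → kappaAt vs (rhos vs) (label v) ≡ rho v
kappaAt-rhos {w ∷ _} (_ ∷ _) (here refl) rewrite ≡ᵇ-refl (label w) = refl
kappaAt-rhos {w ∷ _} {v} (w< ∷ sorted) (there v∈) rewrite <⇒≡ᵇ-false (label w) (label v) (All.lookup w< v∈) =
  kappaAt-rhos sorted v∈

kappaAt-rhos-at : ∀ {vs} {P : ℕ → Set} {i} → AllPairs _<ₗ_ vs → Any (λ v → label v ≡ i × P (rho v)) vs → P (kappaAt vs (rhos vs) i)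
kappaAt-rhos-at {P = P} sorted witness with find witness
... | v , v∈ , refl , Pρ = subst P (sym (kappaAt-rhos sorted v∈)) Pρ

leftCheck : List NodeInfo → List ℕ → ℕ → Maybe ℕ → Bool
leftCheck vs κ lb nothing = true
leftCheck vs κ lb (just l) = kappaAt vs κ lb ≤ᵇ kappaAt vs κ l

rightCheck : List NodeInfo → List ℕ → ℕ → Maybe ℕ → Bool
rightCheck vs κ lb nothing = true
rightCheck vs κ lb (just r) = kappaAt vs κ lb <ᵇ kappaAt vs κ r

-- The node checks of validκ are local to its where block; unification names them here.
record ValidUnfold (vs : List NodeInfo) (κ : List ℕ) : Set where
  field
    check : NodeInfo → Bool → Bool
    unfold : validκ vs κ ≡ foldr check true vs
    check-node : ∀ lb ρ lc rc → check (ninfo lb ρ lc rc) true ≡ (leftCheck vs κ lb lc ∧ (rightCheck vs κ lb rc ∧ true))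

validUnfold : ∀ vs κ → ValidUnfold vs κ
validUnfold vs κ = record
  { check = _
  ; unfold = refl
  ; check-node = λ where
      lb ρ nothing nothing → refl
      lb ρ nothing (just _) → refl
      lb ρ (just _) nothing → refl
      lb ρ (just _) (just _) → refl
  }

foldr-true : ∀ (k : NodeInfo → Bool → Bool) ws → All (λ u → k u true ≡ true) ws → foldr k true ws ≡ true
foldr-true k [] [] = refl
foldr-true k (w ∷ ws) (p ∷ ps) rewrite foldr-true k ws ps = p

rhos-valid : ∀ F → validκ (forestNodes F) (rhosF F) ≡ true
rhos-valid F = trans unfold (foldr-true check vs (All.tabulate node-ok))
  where
  vs = forestNodes F
  κ = rhos vs
  open ValidUnfold (validUnfold vs κ)
  sorted = forestNodes-sorted F
  node-ok : ∀ {u} → u ∈ vs → check u true ≡ true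
  node-ok {ninfo lb ρ lc rc} u∈ with All.lookup (forest-childRhos F 1) u∈
  ... | childRhos L R = trans (check-node lb ρ lc rc) (cong₂ _∧_ (left lc L) (cong (_∧ true) (right rc R)))
    where
    κ-u : kappaAt vs κ lb ≡ ρ
    κ-u = kappaAt-rhos sorted u∈
    left : ∀ lc → (∀ l → lc ≡ just l → Any (λ v → label v ≡ l × rho v ≡ ρ) vs) → leftCheck vs κ lb lc ≡ true
    left nothing _ = refl
    left (just l) L = Equivalence.to T-≡ (NP.≤⇒≤ᵇ (NP.≤-reflexive
      (trans κ-u (sym (kappaAt-rhos-at {P = _≡ ρ} sorted (L l refl))))))
    right : ∀ rc → (∀ r → rc ≡ just r → Any (λ v → label v ≡ r × ρ < rho v) vs) → rightCheck vs κ lb rc ≡ true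
    right nothing _ = refl
    right (just r) R = Equivalence.to T-≡ (NP.<⇒<ᵇ (subst (_< kappaAt vs κ r) (sym κ-u) (kappaAt-rhos-at {P = ρ <_} sorted (R r refl))))

data Below : List ℕ → List ℕ → Set where
  [] : Below [] []
  _∷_ : ∀ {k r κ ρ} → 1 ≤ k × k ≤ r → Below κ ρ → Below (k ∷ κ) (r ∷ ρ)

below-pos : ∀ {κ ρ} → Below κ ρ → All (1 ≤_) κ
below-pos [] = []
below-pos ((1≤k , _) ∷ below) = 1≤k ∷ below-pos below

below-≤ : ∀ {κ ρ n} → Below κ ρ → All (_≤ n) ρ → All (_≤ n) κ
below-≤ [] [] = []
below-≤ ((_ , k≤r) ∷ below) (r≤n ∷ ρ≤n) = NP.≤-trans k≤r r≤n ∷ below-≤ below ρ≤n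

below⇒≡⊎sum< : ∀ {κ ρ} → Below κ ρ → κ ≡ ρ ⊎ sum κ < sum ρ
below⇒≡⊎sum< [] = inj₁ refl
below⇒≡⊎sum< {k ∷ κ} ((_ , k≤r) ∷ below) with NP.m≤n⇒m<n∨m≡n k≤r | below⇒≡⊎sum< below
... | inj₂ refl | inj₁ refl = inj₁ refl
... | inj₂ refl | inj₂ κ< = inj₂ (NP.+-monoʳ-< k κ<)
... | inj₁ k<r | inj₁ refl = inj₂ (NP.+-monoˡ-< (sum κ) k<r)
... | inj₁ k<r | inj₂ κ< = inj₂ (NP.+-mono-<-≤ k<r (NP.<⇒≤ κ<))

assignments-below : ∀ vs → All (λ κ → Below κ (rhos vs)) (assignments vs)
assignments-below [] = [] ∷ []
assignments-below (v ∷ vs) = AllP.concat⁺ (AllP.map⁺ (AllP.applyUpTo⁺₁ id (rho v)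
  (λ k<ρ → AllP.map⁺ (All.map ((s≤s z≤n , k<ρ) ∷_) (assignments-below vs)))))

labelings : IndFor₊ → List (List ℕ)
labelings F = filterᵇ (validκ (forestNodes F)) (assignments (forestNodes F))

labelings-below : ∀ F → All (λ κ → Below κ (rhosF F)) (labelings F)
labelings-below F = AllP.filter⁺ (T? ∘ validκ (forestNodes F)) (assignments-below (forestNodes F))

δₗ : List ℕ → List ℕ → ℕ
δₗ κ κ′ = if does (≡-dec NP._≟_ κ κ′) then 1 else 0

δₗ-∷ : ∀ k κ k′ κ′ → δₗ (k ∷ κ) (k′ ∷ κ′) ≡ δ k k′ * δₗ κ κ′
δₗ-∷ k κ k′ κ′ with k ≡ᵇ k′
... | true = sym (NP.+-identityʳ _)
... | false = refl

multiplicity : List ℕ → List (List ℕ) → ℕ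
multiplicity κ′ [] = 0
multiplicity κ′ (κ ∷ L) = δₗ κ κ′ + multiplicity κ′ L

multiplicity-++ : ∀ κ′ L L′ → multiplicity κ′ (L ++ L′) ≡ multiplicity κ′ L + multiplicity κ′ L′
multiplicity-++ κ′ [] L′ = refl
multiplicity-++ κ′ (κ ∷ L) L′ = trans (cong (δₗ κ κ′ +_) (multiplicity-++ κ′ L L′)) (sym (NP.+-assoc (δₗ κ κ′) _ _))

multiplicity-filter : ∀ p κ′ L → p κ′ ≡ true → multiplicity κ′ (filterᵇ p L) ≡ multiplicity κ′ L
multiplicity-filter p κ′ [] _ = refl
multiplicity-filter p κ′ (κ ∷ L) pκ′ with p κ in e
... | true = cong (δₗ κ κ′ +_) (multiplicity-filter p κ′ L pκ′)
... | false with ≡-dec NP._≟_ κ κ′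
...   | yes refl with () ← trans (sym e) pκ′
...   | no _ = multiplicity-filter p κ′ L pκ′

multiplicity-map-∷ : ∀ k k′ κ′ L → multiplicity (k′ ∷ κ′) (map (k ∷_) L) ≡ δ k k′ * multiplicity κ′ L
multiplicity-map-∷ k k′ κ′ [] = sym (NP.*-zeroʳ (δ k k′))
multiplicity-map-∷ k k′ κ′ (κ ∷ L) = trans (cong₂ _+_ (δₗ-∷ k κ k′ κ′) (multiplicity-map-∷ k k′ κ′ L))
  (sym (NP.*-distribˡ-+ (δ k k′) _ _))

multiplicity-concatMap : ∀ k′ κ′ L ks →
  multiplicity (k′ ∷ κ′) (concatMap (λ k → map (suc k ∷_) L) ks) ≡ count k′ (map suc ks) * multiplicity κ′ L
multiplicity-concatMap k′ κ′ L [] = refl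
multiplicity-concatMap k′ κ′ L (k ∷ ks) = begin
  multiplicity (k′ ∷ κ′) (map (suc k ∷_) L ++ rest)                   ≡⟨ multiplicity-++ (k′ ∷ κ′) (map (suc k ∷_) L) rest ⟩
  multiplicity (k′ ∷ κ′) (map (suc k ∷_) L) + multiplicity (k′ ∷ κ′) rest
    ≡⟨ cong₂ _+_ (multiplicity-map-∷ (suc k) k′ κ′ L) (multiplicity-concatMap k′ κ′ L ks) ⟩
  δ (suc k) k′ * multiplicity κ′ L + count k′ (map suc ks) * multiplicity κ′ L
    ≡⟨ NP.*-distribʳ-+ (multiplicity κ′ L) (δ (suc k) k′) _ ⟨
  (δ (suc k) k′ + count k′ (map suc ks)) * multiplicity κ′ L           ≡⟨ cong (_* multiplicity κ′ L) (count-∷ k′ (suc k) (map suc ks)) ⟨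
  count k′ (map suc (k ∷ ks)) * multiplicity κ′ L                      ∎
  where
  open ≡-Reasoning
  rest = concatMap (λ k → map (suc k ∷_) L) ks

multiplicity-rhos-assignments : ∀ vs → All (λ v → 1 ≤ rho v) vs → multiplicity (rhos vs) (assignments vs) ≡ 1
multiplicity-rhos-assignments [] [] = refl
multiplicity-rhos-assignments (v ∷ vs) (1≤ρ ∷ pos) with rho v | 1≤ρ
... | suc r | _ = trans (multiplicity-concatMap (suc r) (rhos vs) (assignments vs) (upTo (suc r)))
  (cong₂ _*_ (trans (count-map-suc r (upTo (suc r))) (count-upTo (suc r) r NP.≤-refl)) (multiplicity-rhos-assignments vs pos))

multiplicity-rhos-labelings : ∀ F → multiplicity (rhosF F) (labelings F) ≡ 1
multiplicity-rhos-labelings F =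
  trans (multiplicity-filter (validκ (forestNodes F)) (rhosF F) (assignments (forestNodes F)) (rhos-valid F))
        (multiplicity-rhos-assignments (forestNodes F) (AllP.map⁻ (rhosF-pos F)))

expAt-map-applyUpTo-< : ∀ (f g : ℕ → ℕ) M i → i < M → expAt (map f (applyUpTo g M)) i ≡ f (g i)
expAt-map-applyUpTo-< f g (suc M) zero _ = refl
expAt-map-applyUpTo-< f g (suc M) (suc i) (s≤s i<M) = expAt-map-applyUpTo-< f (g ∘ suc) M i i<M

expAt-map-applyUpTo-≥ : ∀ (f g : ℕ → ℕ) M i → M ≤ i → expAt (map f (applyUpTo g M)) i ≡ 0
expAt-map-applyUpTo-≥ f g zero i _ = refl
expAt-map-applyUpTo-≥ f g (suc M) (suc i) (s≤s M≤i) = expAt-map-applyUpTo-≥ f (g ∘ suc) M i M≤i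

all-≤-max : ∀ ks → All (_≤ foldr _⊔_ 0 ks) ks
all-≤-max [] = []
all-≤-max (k ∷ ks) = NP.m≤m⊔n k _ ∷ All.map (λ p → NP.≤-trans p (NP.m≤n⊔m k _)) (all-≤-max ks)

expAt-monOf : ∀ κ i → expAt (monOf κ) i ≡ count (suc i) κ
expAt-monOf κ i with i ℕ.<? foldr _⊔_ 0 κ
... | yes i<max = expAt-map-applyUpTo-< (λ i → count (suc i) κ) id _ i i<max
... | no i≮max = trans (expAt-map-applyUpTo-≥ (λ i → count (suc i) κ) id _ i (NP.≮⇒≥ i≮max))
  (sym (count-all-< (suc i) κ (All.map (λ p → s≤s (NP.≤-trans p (NP.≮⇒≥ i≮max))) (all-≤-max κ))))

monOf-rhos-decode : ∀ m → monOf (rhosF (decode m)) ≋ m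
monOf-rhos-decode m i = trans (expAt-monOf (rhosF (decode m)) i) (count-rhos-decode m i)

module _ {I : Set} {f : I → Poly} {Q : I → Set} where

  InSpan-[] : InSpan f Q []
  InSpan-[] = [] , [] , λ _ → refl

  InSpan-++ : ∀ {p q} → InSpan f Q p → InSpan f Q q → InSpan f Q (p ++ q)
  InSpan-++ {p} {q} (cs , Qcs , p≈) (ds , Qds , q≈) = cs ++ ds , AllP.++⁺ Qcs Qds , λ m →
    trans (coeff-++ p q m) (trans (cong₂ _+ℚ_ (p≈ m) (q≈ m)) (sym (linComb-++ f cs ds m)))

  InSpan-scaleP : ∀ c {p} → InSpan f Q p → InSpan f Q (scaleP c p)
  InSpan-scaleP c {p} (cs , Qcs , p≈) = scaleCoeffs f c cs , AllP.map⁺ Qcs , λ m →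
    trans (coeff-scaleP c p m) (trans (cong (c *ℚ_) (p≈ m)) (sym (linComb-scaleCoeffs f c cs m)))

  InSpan-poly : ∀ p → All (λ (_ , m) → InSpan f Q ((1ℚ , m) ∷ [])) p → InSpan f Q p
  InSpan-poly [] [] = InSpan-[]
  InSpan-poly ((c , m) ∷ p) (span-m ∷ span-p) =
    InSpan-resp f ((c , m) ∷ p) (scaleP c ((1ℚ , m) ∷ []) ++ p) c·m≈ (InSpan-++ {scaleP c ((1ℚ , m) ∷ [])} {p} (InSpan-scaleP c {(1ℚ , m) ∷ []} span-m) (InSpan-poly p span-p))
    where
    c·m≈ : ((c , m) ∷ p) ≈ₚ (scaleP c ((1ℚ , m) ∷ []) ++ p)
    c·m≈ m′ rewrite QP.*-identityʳ c = refl

termsOf : List (List ℕ) → Poly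
termsOf = map (λ κ → (1ℚ , monOf κ))

others : List ℕ → List (List ℕ) → List (List ℕ)
others ρ = filterᵇ (λ κ → not (does (≡-dec NP._≟_ κ ρ)))

others-multiplicity0 : ∀ ρ L → multiplicity ρ L ≡ 0 → others ρ L ≡ L
others-multiplicity0 ρ [] _ = refl
others-multiplicity0 ρ (κ ∷ L) none with ≡-dec NP._≟_ κ ρ
... | no _ = cong (κ ∷_) (others-multiplicity0 ρ L none)

coeff-termsOf-others : ∀ ρ L m → multiplicity ρ L ≡ 1 →
  coeff (termsOf L) m ≡ indicator (monEq (monOf ρ) m) +ℚ coeff (termsOf (others ρ L)) m
coeff-termsOf-others ρ (κ ∷ L) m once with ≡-dec NP._≟_ κ ρ
... | yes refl rewrite others-multiplicity0 ρ L (NP.suc-injective once) =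
  trans (coeff-∷ 1ℚ (monOf ρ) (termsOf L) m) (cong (_+ℚ coeff (termsOf L) m) (QP.*-identityˡ (indicator (monEq (monOf ρ) m))))
... | no _ = begin
  coeff ((1ℚ , monOf κ) ∷ termsOf L) m                  ≡⟨ coeff-∷ 1ℚ (monOf κ) (termsOf L) m ⟩
  1ℚ *ℚ indicator (monEq (monOf κ) m) +ℚ coeff (termsOf L) m
    ≡⟨ cong (a +ℚ_) (coeff-termsOf-others ρ L m once) ⟩
  a +ℚ (b +ℚ coeff (termsOf (others ρ L)) m)            ≡⟨ +ℚ-swapˡ a b (coeff (termsOf (others ρ L)) m) ⟩
  b +ℚ (a +ℚ coeff (termsOf (others ρ L)) m)            ≡⟨ cong (b +ℚ_) (coeff-∷ 1ℚ (monOf κ) (termsOf (others ρ L)) m) ⟨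
  b +ℚ coeff ((1ℚ , monOf κ) ∷ termsOf (others ρ L)) m ∎
  where
  open ≡-Reasoning
  a = 1ℚ *ℚ indicator (monEq (monOf κ) m)
  b = indicator (monEq (monOf ρ) m)

coeff-termsOf-none : ∀ L m → All (λ κ → monEq (monOf κ) m ≡ false) L → coeff (termsOf L) m ≡ 0ℚ
coeff-termsOf-none [] m [] = refl
coeff-termsOf-none (κ ∷ L) m (miss ∷ misses) rewrite miss = coeff-termsOf-none L m misses

InSpan-linComb : ∀ {I J : Set} {f : I → Poly} {g : J → Poly} {R : J → Set} cs →
  All (λ (_ , i) → InSpan g R (f i)) cs → InSpan g R (linComb f cs)
InSpan-linComb [] [] = InSpan-[]
InSpan-linComb {f = f} ((c , i) ∷ cs) (span-i ∷ span-cs) =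
  InSpan-++ {p = scaleP c (f i)} (InSpan-scaleP c {f i} span-i) (InSpan-linComb cs span-cs)

InSpan-trans : ∀ {I J : Set} {f : I → Poly} {Q : I → Set} {g : J → Poly} {R : J → Set} →
  (∀ i → Q i → InSpan g R (f i)) → ∀ p → InSpan f Q p → InSpan g R p
InSpan-trans {f = f} {g = g} members p (cs , Qcs , p≈) =
  InSpan-resp g p (linComb f cs) p≈ (InSpan-linComb cs (All.map (λ {t} → members (proj₂ t)) Qcs))

sumQ : List ℚ → ℚ
sumQ = foldr _+ℚ_ 0ℚ

sumQ-cong : ∀ {A : Set} (g h : A → ℚ) xs → All (λ x → g x ≡ h x) xs → sumQ (map g xs) ≡ sumQ (map h xs)
sumQ-cong g h [] [] = refl
sumQ-cong g h (x ∷ xs) (p ∷ ps) = cong₂ _+ℚ_ p (sumQ-cong g h xs ps)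

module Unitriangular {I : Set} (_≟I_ : DecidableEquality I) (f : I → Poly) (lead : I → Mon) (weight : I → ℕ)
  (coeff-lead : ∀ i → coeff (f i) (lead i) ≡ 1ℚ)
  (coeff-lead-other : ∀ i j → weight j ≤ weight i → j ≢ i → coeff (f j) (lead i) ≡ 0ℚ) where

  coeff-linComb : ∀ cs m → coeff (linComb f cs) m ≡ sumQ (map (λ (c , j) → c *ℚ coeff (f j) m) cs)
  coeff-linComb [] m = refl
  coeff-linComb ((c , j) ∷ cs) m = trans (linComb-∷ f c j cs m) (cong (c *ℚ coeff (f j) m +ℚ_) (coeff-linComb cs m))

  coeffAt : I → ℚ × I → ℚ
  coeffAt i (c , j) = if does (j ≟I i) then c else 0ℚ

  sumQ-coeffAt-absent : ∀ i cs → All (λ (_ , j) → j ≢ i) cs → sumQ (map (coeffAt i) cs) ≡ 0ℚ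
  sumQ-coeffAt-absent i [] [] = refl
  sumQ-coeffAt-absent i ((c , j) ∷ cs) (j≢i ∷ rest) with j ≟I i
  ... | yes j≡i = ⊥-elim (j≢i j≡i)
  ... | no _ = trans (QP.+-identityˡ _) (sumQ-coeffAt-absent i cs rest)

  sumQ-coeffAt-unique : ∀ cs c i → (c , i) ∈ cs → AllPairs (λ (_ , j) (_ , k) → j ≢ k) cs → sumQ (map (coeffAt i) cs) ≡ c
  sumQ-coeffAt-unique ((c , i) ∷ cs) c i (here refl) (i≢ ∷ _) with i ≟I i
  ... | yes _ = trans (cong (c +ℚ_) (sumQ-coeffAt-absent i cs (All.map (λ i≢j j≡i → i≢j (sym j≡i)) i≢))) (QP.+-identityʳ c)
  ... | no i≢i = ⊥-elim (i≢i refl)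
  sumQ-coeffAt-unique ((c′ , j) ∷ cs) c i (there i∈) (j≢ ∷ distinct) with j ≟I i
  ... | yes refl = ⊥-elim (All.lookup j≢ i∈ refl)
  ... | no _ = trans (QP.+-identityˡ _) (sumQ-coeffAt-unique cs c i i∈ distinct)

  maxWeight : List (ℚ × I) → ℕ
  maxWeight = foldr (λ (_ , j) w → weight j ⊔ w) 0

  maxWeight-bound : ∀ cs t → t ∈ cs → weight (proj₂ t) ≤ maxWeight cs
  maxWeight-bound (t ∷ cs) t (here refl) = NP.m≤m⊔n _ _
  maxWeight-bound (_ ∷ cs) t (there t∈) = NP.≤-trans (maxWeight-bound cs t t∈) (NP.m≤n⊔m _ _)

  module _ (cs : List (ℚ × I)) (distinct : AllPairs (λ (_ , j) (_ , k) → j ≢ k) cs)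
           (vanishes : linComb f cs ≈ₚ zeroP) where

    -- Read off the coefficient of lead i: only i itself and heavier members can contribute.
    heavier-zero⇒zero : ∀ c i → (c , i) ∈ cs →
      (∀ t → t ∈ cs → weight i < weight (proj₂ t) → proj₁ t ≡ 0ℚ) → c ≡ 0ℚ
    heavier-zero⇒zero c i i∈ heavier = begin
      c                                                        ≡⟨ sumQ-coeffAt-unique cs c i i∈ distinct ⟨
      sumQ (map (coeffAt i) cs)                                ≡⟨ sumQ-cong _ _ cs (All.tabulate contribution) ⟨
      sumQ (map (λ (c , j) → c *ℚ coeff (f j) (lead i)) cs)   ≡⟨ coeff-linComb cs (lead i) ⟨
      coeff (linComb f cs) (lead i)                            ≡⟨ vanishes (lead i) ⟩
      0ℚ                                                       ∎
      where
      open ≡-Reasoning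
      contribution : ∀ {t} → t ∈ cs → proj₁ t *ℚ coeff (f (proj₂ t)) (lead i) ≡ coeffAt i t
      contribution {c′ , j} j∈ with j ≟I i
      ... | yes refl = trans (cong (c′ *ℚ_) (coeff-lead i)) (QP.*-identityʳ c′)
      ... | no j≢i with weight j ℕ.≤? weight i
      ...   | yes j≤i = trans (cong (c′ *ℚ_) (coeff-lead-other i j j≤i j≢i)) (QP.*-zeroʳ c′)
      ...   | no j≰i = trans (cong (_*ℚ coeff (f j) (lead i)) (heavier (c′ , j) j∈ (NP.≰⇒> j≰i))) (QP.*-zeroˡ (coeff (f j) (lead i)))

    -- Induction on the distance d of a weight from the maximal weight.
    zero-within : ∀ d t → t ∈ cs → maxWeight cs ∸ weight (proj₂ t) ≤ d → proj₁ t ≡ 0ℚ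
    heavier-zero : ∀ d i → maxWeight cs ∸ weight i ≤ d → ∀ t → t ∈ cs → weight i < weight (proj₂ t) → proj₁ t ≡ 0ℚ

    zero-within d (c , i) i∈ within = heavier-zero⇒zero c i i∈ (heavier-zero d i within)

    heavier-zero zero i within t t∈ i<t = ⊥-elim (NP.<-irrefl refl
      (NP.<-≤-trans (NP.≤-<-trans (NP.m∸n≡0⇒m≤n (NP.n≤0⇒n≡0 within)) i<t) (maxWeight-bound cs t t∈)))
    heavier-zero (suc d) i within t t∈ i<t =
      zero-within d t t∈ (NP.≤-pred (NP.<-≤-trans (NP.∸-monoʳ-< i<t (maxWeight-bound cs t t∈)) within))

    all-zero : All (λ t → proj₁ t ≡ 0ℚ) cs
    all-zero = All.tabulate (λ {t} t∈ → zero-within (maxWeight cs) t t∈ (NP.m∸n≤m _ (weight (proj₂ t))))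

  linIndep : ∀ Q → LinIndep f Q
  linIndep Q cs _ unique vanishes = all-zero cs (AllPairsP.map⁻ unique) vanishes

-- Leading terms of forest polynomials

μ : IndFor₊ → ℕ
μ F = sum (rhosF F)

leadMon : IndFor₊ → Mon
leadMon F = monOf (rhosF F)

monEq-monOf⇒counts : ∀ κ κ′ → monEq (monOf κ) (monOf κ′) ≡ true → ∀ i → count (suc i) κ ≡ count (suc i) κ′
monEq-monOf⇒counts κ κ′ eq i = trans (sym (expAt-monOf κ i)) (trans (monEq⇒≋ (monOf κ) (monOf κ′) eq i) (expAt-monOf κ′ i))

sum<⇒monEq-false : ∀ κ ρ → All (1 ≤_) κ → All (1 ≤_) ρ → sum κ < sum ρ → monEq (monOf κ) (monOf ρ) ≡ false
sum<⇒monEq-false κ ρ κ-pos ρ-pos κ<ρ with monEq (monOf κ) (monOf ρ) in eq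
... | false = refl
... | true = ⊥-elim (NP.<⇒≢ κ<ρ (sum-cong-counts κ ρ κ-pos ρ-pos (monEq-monOf⇒counts κ ρ eq)))

μ-decode-monOf : ∀ κ → All (1 ≤_) κ → μ (decode (monOf κ)) ≡ sum κ
μ-decode-monOf κ κ-pos = sum-cong-counts _ κ (rhosF-pos (decode (monOf κ))) κ-pos
  (λ i → trans (count-rhos-decode (monOf κ) i) (expAt-monOf κ i))

lowerLabelings : IndFor₊ → List (List ℕ)
lowerLabelings F = others (rhosF F) (labelings F)

lowerLabelings-lower : ∀ F → All (λ κ → Below κ (rhosF F) × sum κ < μ F) (lowerLabelings F)
lowerLabelings-lower F = All.zipWith (λ (below , κ≢ρ) → below , lower below κ≢ρ)
  (AllP.filter⁺ (T? ∘ isOther) (labelings-below F) , AllP.all-filter (T? ∘ isOther) (labelings F))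
  where
  isOther : List ℕ → Bool
  isOther κ = not (does (≡-dec NP._≟_ κ (rhosF F)))
  lower : ∀ {κ} → Below κ (rhosF F) → T (isOther κ) → sum κ < μ F
  lower {κ} below other with ≡-dec NP._≟_ κ (rhosF F) | below⇒≡⊎sum< below
  ... | no _ | inj₂ κ<ρ = κ<ρ
  ... | no κ≢ρ | inj₁ κ≡ρ = ⊥-elim (κ≢ρ κ≡ρ)

coeff-forestPoly : ∀ F m → coeff (forestPoly F) m ≡ indicator (monEq (leadMon F) m) +ℚ coeff (termsOf (lowerLabelings F)) m
coeff-forestPoly F m = coeff-termsOf-others (rhosF F) (labelings F) m (multiplicity-rhos-labelings F)

coeff-forestPoly-lead : ∀ F → coeff (forestPoly F) (leadMon F) ≡ 1ℚ
coeff-forestPoly-lead F = begin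
  coeff (forestPoly F) (leadMon F)                                                     ≡⟨ coeff-forestPoly F (leadMon F) ⟩
  indicator (monEq (leadMon F) (leadMon F)) +ℚ coeff (termsOf (lowerLabelings F)) (leadMon F)
    ≡⟨ cong₂ _+ℚ_ (cong indicator (≋⇒monEq (leadMon F) (leadMon F) (λ _ → refl))) lower-absent ⟩
  1ℚ +ℚ 0ℚ                                                                             ≡⟨ QP.+-identityʳ 1ℚ ⟩
  1ℚ                                                                                   ∎
  where
  open ≡-Reasoning
  lower-absent : coeff (termsOf (lowerLabelings F)) (leadMon F) ≡ 0ℚ
  lower-absent = coeff-termsOf-none (lowerLabelings F) (leadMon F) (All.map (λ (below , κ<ρ) → sum<⇒monEq-false _ _ (below-pos below) (rhosF-pos F) κ<ρ)
    (lowerLabelings-lower F))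

coeff-forestPoly-lead-other : ∀ F G → μ G ≤ μ F → G ≢ F → coeff (forestPoly G) (leadMon F) ≡ 0ℚ
coeff-forestPoly-lead-other F G G≤F G≢F = coeff-termsOf-none (labelings G) (leadMon F) (All.map absent (labelings-below G))
  where
  absent : ∀ {κ} → Below κ (rhosF G) → monEq (monOf κ) (leadMon F) ≡ false
  absent {κ} below with monEq (monOf κ) (leadMon F) in eq
  ... | false = refl
  ... | true with below⇒≡⊎sum< below
  ...   | inj₁ refl = ⊥-elim (G≢F (rhos-injective G F (monEq-monOf⇒counts (rhosF G) (rhosF F) eq)))
  ...   | inj₂ κ<ρ = ⊥-elim (NP.<-irrefl
            (sum-cong-counts κ (rhosF F) (below-pos below) (rhosF-pos F) (monEq-monOf⇒counts κ (rhosF F) eq))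
            (NP.<-≤-trans κ<ρ G≤F))

_≟T_ : DecidableEquality Tree
leaf ≟T leaf = yes refl
leaf ≟T node _ _ = no λ ()
node _ _ ≟T leaf = no λ ()
node l r ≟T node l′ r′ with l ≟T l′ | r ≟T r′
... | yes refl | yes refl = yes refl
... | no l≢l′ | _ = no λ { refl → l≢l′ refl }
... | yes _ | no r≢r′ = no λ { refl → r≢r′ refl }

_≟B_ : DecidableEquality Block
blk g l r ≟B blk g′ l′ r′ with g NP.≟ g′ | l ≟T l′ | r ≟T r′
... | yes refl | yes refl | yes refl = yes refl
... | no g≢g′ | _ | _ = no λ { refl → g≢g′ refl }
... | yes _ | no l≢l′ | _ = no λ { refl → l≢l′ refl }
... | yes _ | yes _ | no r≢r′ = no λ { refl → r≢r′ refl }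

forestPoly-linIndep : ∀ Q → LinIndep forestPoly Q
forestPoly-linIndep = Unitriangular.linIndep (≡-dec _≟B_) forestPoly leadMon μ coeff-forestPoly-lead
  (λ F G G≤F G≢F → coeff-forestPoly-lead-other F G G≤F G≢F)

InSpan-member : ∀ {I : Set} {f : I → Poly} {Q : I → Set} {i} → Q i → InSpan f Q (f i)
InSpan-member {f = f} {i = i} Qi = (1ℚ , i) ∷ [] , Qi ∷ [] , λ m → sym (begin
  coeff (linComb f ((1ℚ , i) ∷ [])) m   ≡⟨ linComb-∷ f 1ℚ i [] m ⟩
  1ℚ *ℚ coeff (f i) m +ℚ 0ℚ             ≡⟨ QP.+-identityʳ _ ⟩
  1ℚ *ℚ coeff (f i) m                   ≡⟨ QP.*-identityˡ _ ⟩
  coeff (f i) m                         ∎)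
  where open ≡-Reasoning

monomial≈forestPoly-lower : ∀ m → ((1ℚ , m) ∷ []) ≈ₚ (forestPoly (decode m) ++ scaleP (- 1ℚ) (termsOf (lowerLabelings (decode m))))
monomial≈forestPoly-lower m m′ = begin
  coeff ((1ℚ , m) ∷ []) m′                          ≡⟨ coeff-monomial m m′ ⟩
  indicator (monEq m m′)                            ≡⟨ cong indicator (monEq-congˡ (leadMon F) m m′ (monOf-rhos-decode m)) ⟨
  a                                                 ≡⟨ QP.+-identityʳ a ⟨
  a +ℚ 0ℚ                                           ≡⟨ cong (a +ℚ_) (QP.+-inverseʳ b) ⟨
  a +ℚ (b +ℚ - b)                                   ≡⟨ QP.+-assoc a b (- b) ⟨
  a +ℚ b +ℚ - b                                     ≡⟨ cong₂ _+ℚ_ (coeff-forestPoly F m′) minus-b ⟨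
  coeff (forestPoly F) m′ +ℚ coeff (scaleP (- 1ℚ) lower) m′ ≡⟨ coeff-++ (forestPoly F) _ m′ ⟨
  coeff (forestPoly F ++ scaleP (- 1ℚ) lower) m′    ∎
  where
  open ≡-Reasoning
  F = decode m
  lower = termsOf (lowerLabelings F)
  a = indicator (monEq (leadMon F) m′)
  b = coeff lower m′
  minus-b : coeff (scaleP (- 1ℚ) lower) m′ ≡ - b
  minus-b = trans (coeff-scaleP (- 1ℚ) lower m′) (trans (sym (QP.neg-distribˡ-* 1ℚ b)) (cong -_ (QP.*-identityˡ b)))

module Spanning (Q : IndFor₊ → Set) (G : Mon → Set)
  (closed : ∀ m → G m → Q (decode m) × All (G ∘ monOf) (labelings (decode m))) where

  span-monomial-fuel : ∀ n m → μ (decode m) < n → G m → InSpan forestPoly Q ((1ℚ , m) ∷ [])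
  span-monomial-fuel (suc n) m μ<n Gm =
    InSpan-resp forestPoly ((1ℚ , m) ∷ []) (forestPoly F ++ scaleP (- 1ℚ) (termsOf lower)) (monomial≈forestPoly-lower m)
      (InSpan-++ {p = forestPoly F} (InSpan-member (proj₁ (closed m Gm))) (InSpan-scaleP (- 1ℚ) {termsOf lower} lower-span))
    where
    F = decode m
    lower = lowerLabelings F
    lower-G : All (G ∘ monOf) lower
    lower-G = AllP.filter⁺ (T? ∘ _) (proj₂ (closed m Gm))
    span-lower : ∀ {κ} → (Below κ (rhosF F) × sum κ < μ F) × G (monOf κ) → InSpan forestPoly Q ((1ℚ , monOf κ) ∷ [])
    span-lower {κ} ((below , κ<F) , Gκ) = span-monomial-fuel n (monOf κ)
      (subst (_< n) (sym (μ-decode-monOf κ (below-pos below))) (NP.<-≤-trans κ<F (NP.≤-pred μ<n))) Gκ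
    lower-span : InSpan forestPoly Q (termsOf lower)
    lower-span = InSpan-poly (termsOf lower) (AllP.map⁺ (All.map span-lower (All.zip (lowerLabelings-lower F , lower-G))))

  span-monomial : ∀ m → G m → InSpan forestPoly Q ((1ℚ , m) ∷ [])
  span-monomial m = span-monomial-fuel (suc (μ (decode m))) m NP.≤-refl

  span : ∀ p → All (G ∘ proj₂) p → InSpan forestPoly Q p
  span p Gp = InSpan-poly p (All.map (span-monomial _) Gp)

tree-noLeft⇒rho≡label : ∀ T a → All (λ u → lch u ≡ nothing → rho u ≡ label u) (treeNodes T a)
tree-noLeft⇒rho≡label leaf a = []
tree-noLeft⇒rho≡label (node l r) a = AllP.++⁺ (tree-noLeft⇒rho≡label l a) (root l ∷ tree-noLeft⇒rho≡label r _)
  where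
  root : ∀ l → rootLabel l a ≡ nothing → leftmost l r a ≡ a + size l
  root leaf _ = sym (NP.+-identityʳ a)

forest-noLeft⇒rho≡label : ∀ F next → All (λ u → lch u ≡ nothing → rho u ≡ label u) (forestNodes' next F)
forest-noLeft⇒rho≡label [] next = []
forest-noLeft⇒rho≡label (blk g l r ∷ bs) next = AllP.++⁺ (tree-noLeft⇒rho≡label (node l r) _) (forest-noLeft⇒rho≡label bs _)

NoLeftWithLabel : List NodeInfo → ℕ → Set
NoLeftWithLabel vs i = Any (λ u → lch u ≡ nothing × label u ≡ i) vs

leftmost-noLeft : ∀ l r a → NoLeftWithLabel (treeNodes (node l r) a) a
leftmost-noLeft leaf r a = here (refl , NP.+-identityʳ a)
leftmost-noLeft (node ll lr) r a = AnyP.++⁺ˡ (leftmost-noLeft ll lr a)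

tree-rho-noLeft : ∀ T a → All (NoLeftWithLabel (treeNodes T a) ∘ rho) (treeNodes T a)
tree-rho-noLeft leaf a = []
tree-rho-noLeft (node l r) a = AllP.++⁺ (All.map AnyP.++⁺ˡ (tree-rho-noLeft l a))
  (subst (NoLeftWithLabel (treeNodes (node l r) a)) (sym (leftmost≡start l r a)) (leftmost-noLeft l r a)
   ∷ All.map (AnyP.++⁺ʳ (treeNodes l a) ∘ there) (tree-rho-noLeft r _))

forest-rho-noLeft : ∀ F next → All (NoLeftWithLabel (forestNodes' next F) ∘ rho) (forestNodes' next F)
forest-rho-noLeft [] next = []
forest-rho-noLeft (blk g l r ∷ bs) next =
  AllP.++⁺ (All.map AnyP.++⁺ˡ (tree-rho-noLeft (node l r) _)) (All.map (AnyP.++⁺ʳ (treeNodes (node l r) (next + g))) (forest-rho-noLeft bs _))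

-- The filter of LSupp is local to its where block; unification names it here.
record LSuppUnfold (F : IndFor₊) : Set where
  field
    noLeft : NodeInfo → Bool
    unfold : LSupp F ≡ map label (filterᵇ noLeft (forestNodes F))
    noLeft-nothing : ∀ lb ρ rc → noLeft (ninfo lb ρ nothing rc) ≡ true
    noLeft-just : ∀ lb ρ l rc → noLeft (ninfo lb ρ (just l) rc) ≡ false

lsuppUnfold : ∀ F → LSuppUnfold F
lsuppUnfold F = record { noLeft = _ ; unfold = refl ; noLeft-nothing = λ _ _ _ → refl ; noLeft-just = λ _ _ _ _ → refl }

noLeft⇒∈LSupp : ∀ F {u} → u ∈ forestNodes F → lch u ≡ nothing → label u ∈ LSupp F
noLeft⇒∈LSupp F {u} u∈ no-left rewrite LSuppUnfold.unfold (lsuppUnfold F) =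
  MP.∈-map⁺ label (MP.∈-filter⁺ (T? ∘ noLeft) u∈ (kept u∈ no-left))
  where
  open LSuppUnfold (lsuppUnfold F)
  kept : ∀ {u} → u ∈ forestNodes F → lch u ≡ nothing → T (noLeft u)
  kept {ninfo lb ρ nothing rc} _ refl rewrite noLeft-nothing lb ρ rc = tt

LSupp⊆⇒rhos≤ : ∀ F n → LSupp F ⊆[ n ] → All (_≤ n) (rhosF F)
LSupp⊆⇒rhos≤ F n lsupp = AllP.map⁺ (All.map (λ {v} → bound {v}) (forest-rho-noLeft F 1))
  where
  bound : ∀ {v} → NoLeftWithLabel (forestNodes F) (rho v) → rho v ≤ n
  bound witness with find witness
  ... | u , u∈ , no-left , refl = proj₂ (All.lookup lsupp (noLeft⇒∈LSupp F u∈ no-left))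

length-normMon≤ : ∀ m n → (∀ i → n ≤ i → expAt m i ≡ 0) → length (normMon m) ≤ n
length-normMon≤ m zero beyond rewrite normMon-zeroes m (λ i → beyond i z≤n) = z≤n
length-normMon≤ [] (suc n) beyond = z≤n
length-normMon≤ (e ∷ es) (suc n) beyond with normMon es | length-normMon≤ es n (λ i n≤i → beyond (suc i) (s≤s n≤i))
... | [] | _ with e
...   | zero = z≤n
...   | suc _ = s≤s z≤n
length-normMon≤ (e ∷ es) (suc n) beyond | _ ∷ _ | ih = s≤s ih

expAt-length : ∀ xs i → length xs ≤ i → expAt xs i ≡ 0
expAt-length [] i _ = refl
expAt-length (x ∷ xs) (suc i) (s≤s len≤i) = expAt-length xs i len≤i

expAt-beyond : ∀ m i → length (normMon m) ≤ i → expAt m i ≡ 0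
expAt-beyond m i len≤i = trans (sym (expAt-normMon m i)) (expAt-length (normMon m) i len≤i)

monOf-inVars : ∀ {n} κ → All (_≤ n) κ → length (normMon (monOf κ)) ≤ n
monOf-inVars κ κ≤n = length-normMon≤ (monOf κ) _ (λ i n≤i →
  trans (expAt-monOf κ i) (count-all-< (suc i) κ (All.map (λ k≤n → s≤s (NP.≤-trans k≤n n≤i)) κ≤n)))

forestPoly-inVars : ∀ n F → LSupp F ⊆[ n ] → InVars n (forestPoly F)
forestPoly-inVars n F lsupp m coeff≢0 with length (normMon m) ℕ.≤? n
... | yes len≤n = len≤n
... | no len≰n = ⊥-elim (coeff≢0 (coeff-termsOf-none (labelings F) m (All.map absent (labelings-below F))))
  where
  absent : ∀ {κ} → Below κ (rhosF F) → monEq (monOf κ) m ≡ false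
  absent {κ} below with monEq (monOf κ) m in eq
  ... | false = refl
  ... | true = ⊥-elim (len≰n (subst (_≤ n) (cong length (normMon-cong (monOf κ) m (monEq⇒≋ (monOf κ) m eq)))
                 (monOf-inVars κ (below-≤ below (LSupp⊆⇒rhos≤ F n lsupp)))))

decode-inVars : ∀ n m → length (normMon m) ≤ n →
  LSupp (decode m) ⊆[ n ] × All (λ κ → length (normMon (monOf κ)) ≤ n) (labelings (decode m))
decode-inVars n m len≤n = lsupp , All.map (λ below → monOf-inVars _ (below-≤ below ρ≤n)) (labelings-below F)
  where
  F = decode m
  ρ≤n : All (_≤ n) (rhosF F)
  ρ≤n = count-above⇒all≤ (rhosF F) n (rhosF-pos F)
    (λ i n≤i → trans (count-rhos-decode m i) (expAt-beyond m i (NP.≤-trans len≤n n≤i)))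
  open LSuppUnfold (lsuppUnfold F)
  in-range : ∀ {u} → (lch u ≡ nothing → rho u ≡ label u) × 1 ≤ rho u × rho u ≤ n → T (noLeft u) → 1 ≤ label u × label u ≤ n
  in-range {ninfo lb ρ nothing rc} (ρ≡lb , 1≤ρ , ρ≤n) _ = subst (1 ≤_) (ρ≡lb refl) 1≤ρ , subst (_≤ n) (ρ≡lb refl) ρ≤n
  in-range {ninfo lb ρ (just l) rc} _ kept rewrite noLeft-just lb ρ l rc = ⊥-elim kept
  lsupp : LSupp F ⊆[ n ]
  lsupp rewrite unfold = AllP.map⁺ (All.zipWith (λ (in-range , kept) → in-range kept)
    (AllP.filter⁺ (T? ∘ noLeft) (All.map (λ {u} → in-range {u}) (All.zip (forest-noLeft⇒rho≡label F 1 , All.zip (AllP.map⁻ (rhosF-pos F) , AllP.map⁻ ρ≤n)))) ,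
     AllP.all-filter (T? ∘ noLeft) (forestNodes F)))

basis : IsBasisOf forestPoly (λ _ → ⊤) (λ _ → ⊤)
basis = (λ _ _ → tt) , (λ p _ → Spanning.span (λ _ → ⊤) (λ _ → ⊤) (λ m _ → tt , All.universal (λ _ → tt) _) p (All.universal (λ _ → tt) p)) ,
  forestPoly-linIndep _

basis-inVars : ∀ n → IsBasisOf forestPoly (λ F → LSupp F ⊆[ n ]) (InVars n)
basis-inVars n = forestPoly-inVars n , span-inVars , forestPoly-linIndep _
  where
  span-inVars : ∀ p → InVars n p → InSpan forestPoly (λ F → LSupp F ⊆[ n ]) p
  span-inVars p p∈ = InSpan-resp forestPoly p (dropZeroTerms p) (dropZeroTerms-≈ p)
    (Spanning.span _ (λ m → length (normMon m) ≤ n) (decode-inVars n) (dropZeroTerms p)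
      (All.map (λ {t} → p∈ (proj₂ t)) (dropZeroTerms-nonzero p)))

-- ABB monomials

sumRange-suc : ∀ f t k → sumRange f (suc t) k ≡ sumRange (f ∘ suc) t k
sumRange-suc f t zero = refl
sumRange-suc f t (suc k) = cong (f (suc t) +_) (sumRange-suc f (suc t) k)

sumRange-expAt-all : ∀ xs → sumRange (expAt xs) 0 (length xs) ≡ sum xs
sumRange-expAt-all [] = refl
sumRange-expAt-all (x ∷ xs) = cong (x +_) (trans (sumRange-suc (expAt (x ∷ xs)) 0 (length xs)) (sumRange-expAt-all xs))

take-++-≤ : ∀ j (xs ys : List ℕ) → j ≤ length xs → take j (xs ++ ys) ≡ take j xs
take-++-≤ zero xs ys _ = refl
take-++-≤ (suc j) (x ∷ xs) ys (s≤s j≤) = cong (x ∷_) (take-++-≤ j xs ys j≤)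

-- The last j entries of xs are those with indices length xs ∸ j, …, length xs ∸ 1.
sum-take-reverse : ∀ xs j → j ≤ length xs → sum (take j (reverse xs)) ≡ sumRange (expAt xs) (length xs ∸ j) j
sum-take-reverse [] zero _ = refl
sum-take-reverse (x ∷ xs) j j≤ rewrite LP.unfold-reverse x xs with NP.m≤n⇒m<n∨m≡n j≤
... | inj₁ (s≤s j≤len) = begin
  sum (take j (reverse xs ++ x ∷ []))                ≡⟨ cong sum (take-++-≤ j (reverse xs) (x ∷ []) (subst (j ≤_) (sym (LP.length-reverse xs)) j≤len)) ⟩
  sum (take j (reverse xs))                          ≡⟨ sum-take-reverse xs j j≤len ⟩
  sumRange (expAt xs) (length xs ∸ j) j              ≡⟨ sumRange-suc (expAt (x ∷ xs)) (length xs ∸ j) j ⟨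
  sumRange (expAt (x ∷ xs)) (suc (length xs ∸ j)) j  ≡⟨ cong (λ t → sumRange (expAt (x ∷ xs)) t j) (NP.+-∸-assoc 1 j≤len) ⟨
  sumRange (expAt (x ∷ xs)) (suc (length xs) ∸ j) j  ∎
  where open ≡-Reasoning
... | inj₂ refl = begin
  sum (take (suc (length xs)) (reverse xs ++ x ∷ []))   ≡⟨ cong sum (LP.take-all _ (reverse xs ++ x ∷ []) (NP.≤-reflexive length-all)) ⟩
  sum (reverse xs ++ x ∷ [])                            ≡⟨ SumP.sum-++ (reverse xs) (x ∷ []) ⟩
  sum (reverse xs) + (x + 0)                            ≡⟨ cong₂ _+_ (SumP.sum-↭ (PermP.↭-reverse xs)) (NP.+-identityʳ x) ⟩
  sum xs + x                                            ≡⟨ NP.+-comm (sum xs) x ⟩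
  x + sum xs                                            ≡⟨ sumRange-expAt-all (x ∷ xs) ⟨
  sumRange (expAt (x ∷ xs)) 0 (suc (length xs))         ≡⟨ cong (λ t → sumRange (expAt (x ∷ xs)) t (suc (length xs))) (NP.n∸n≡0 (length xs)) ⟨
  sumRange (expAt (x ∷ xs)) (length xs ∸ length xs) (suc (length xs)) ∎
  where
  open ≡-Reasoning
  length-all : length (reverse xs ++ x ∷ []) ≡ suc (length xs)
  length-all = trans (LP.length-++ (reverse xs)) (trans (NP.+-comm (length (reverse xs)) 1) (cong suc (LP.length-reverse xs)))

ABBFun : ℕ → (ℕ → ℕ) → Set
ABBFun n f = (∀ i → n ≤ i → f i ≡ 0) × (∀ j → 1 ≤ j → j ≤ n → sumRange f (n ∸ j) j ≤ j ∸ 1)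

ABBFun-cong : ∀ {n f g} → (∀ i → f i ≡ g i) → ABBFun n f → ABBFun n g
ABBFun-cong {n} f≗g (beyond , tails) = (λ i n≤i → trans (sym (f≗g i)) (beyond i n≤i)) ,
  (λ j 1≤j j≤n → subst (_≤ j ∸ 1) (sumRange-cong (n ∸ j) j f≗g) (tails j 1≤j j≤n))

sum-take-reverse-toList : ∀ {n} (c : Vec ℕ n) j → j ≤ n → sum (take j (reverse (toList c))) ≡ sumRange (expAt (toList c)) (n ∸ j) j
sum-take-reverse-toList {n} c j j≤n =
  trans (sum-take-reverse (toList c) j (subst (j ≤_) (sym (VecP.length-toList c)) j≤n))
        (cong (λ len → sumRange (expAt (toList c)) (len ∸ j) j) (VecP.length-toList c))

ABB⇒ABBFun : ∀ n (c : Vec ℕ n) → ABB n c → ABBFun n (expAt (toList c))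
ABB⇒ABBFun n c abb = (λ i n≤i → expAt-length (toList c) i (subst (_≤ i) (sym (VecP.length-toList c)) n≤i)) ,
  (λ j 1≤j j≤n → subst (_≤ j ∸ 1) (sum-take-reverse-toList c j j≤n) (abb j 1≤j j≤n))

ABBFun⇒ABB : ∀ n (c : Vec ℕ n) → ABBFun n (expAt (toList c)) → ABB n c
ABBFun⇒ABB n c (_ , tails) j 1≤j j≤n = subst (_≤ j ∸ 1) (sym (sum-take-reverse-toList c j j≤n)) (tails j 1≤j j≤n)

vecOf : (n : ℕ) → (ℕ → ℕ) → Vec ℕ n
vecOf zero f = Vec.[]
vecOf (suc n) f = f 0 Vec.∷ vecOf n (f ∘ suc)

expAt-vecOf : ∀ n f → (∀ i → n ≤ i → f i ≡ 0) → ∀ i → expAt (toList (vecOf n f)) i ≡ f i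
expAt-vecOf zero f beyond i = sym (beyond i z≤n)
expAt-vecOf (suc n) f beyond zero = refl
expAt-vecOf (suc n) f beyond (suc i) = expAt-vecOf n (f ∘ suc) (λ i n≤i → beyond (suc i) (s≤s n≤i)) i

isAbove-mono : ∀ t {k y} → k ≤ y → isAbove t k ≤ isAbove t y
isAbove-mono t {k} {y} k≤y with t <ᵇ k in ek | t <ᵇ y in ey
... | false | _ = z≤n
... | true | true = NP.≤-refl
... | true | false = ⊥-elim (subst T ey (NP.<⇒<ᵇ (NP.<-≤-trans (NP.<ᵇ⇒< t k (subst T (sym ek) tt)) k≤y)))

countAbove-mono : ∀ t {ks ys} → Pointwise _≤_ ks ys → countAbove t ks ≤ countAbove t ys
countAbove-mono t [] = z≤n
countAbove-mono t {k ∷ ks} {y ∷ ys} (k≤y ∷ ks≤ys) rewrite countAbove-∷ t k ks | countAbove-∷ t y ys =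
  NP.+-mono-≤ (isAbove-mono t k≤y) (countAbove-mono t ks≤ys)

sorted-length : ∀ xs a b → AllPairs _<_ xs → All (λ x → a ≤ x × x ≤ b) xs → length xs ≤ suc b ∸ a
sorted-length [] a b _ _ = z≤n
sorted-length (x ∷ xs) a b (x< ∷ sorted) ((a≤x , x≤b) ∷ bounds) =
  subst (suc (length xs) ≤_) (sym (NP.+-∸-assoc 1 (NP.≤-trans a≤x x≤b)))
    (s≤s (NP.≤-trans (sorted-length xs (suc x) b sorted (All.zipWith (λ (x<y , (_ , y≤b)) → x<y , y≤b) (x< , bounds)))
                     (NP.∸-monoʳ-≤ b a≤x)))

tree-rho≤label : ∀ T a → All (λ v → rho v ≤ label v) (treeNodes T a)
tree-rho≤label leaf a = []
tree-rho≤label (node l r) a =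
  AllP.++⁺ (tree-rho≤label l a) (subst (_≤ a + size l) (sym (leftmost≡start l r a)) (NP.m≤m+n a (size l)) ∷ tree-rho≤label r _)

forest-rho≤label : ∀ F next → All (λ v → rho v ≤ label v) (forestNodes' next F)
forest-rho≤label [] next = []
forest-rho≤label (blk g l r ∷ bs) next = AllP.++⁺ (tree-rho≤label (node l r) _) (forest-rho≤label bs _)

below⇒≤labels : ∀ vs {κ} → Below κ (rhos vs) → All (λ v → rho v ≤ label v) vs → Pointwise _≤_ κ (map label vs)
below⇒≤labels [] [] [] = []
below⇒≤labels (v ∷ vs) ((_ , k≤ρ) ∷ below) (ρ≤label ∷ rest) = NP.≤-trans k≤ρ ρ≤label ∷ below⇒≤labels vs below rest

pointwise-≤-bound : ∀ {ks ys b} → Pointwise _≤_ ks ys → All (_≤ b) ys → All (_≤ b) ks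
pointwise-≤-bound [] [] = []
pointwise-≤-bound (k≤y ∷ ks≤ys) (y≤b ∷ ys≤b) = NP.≤-trans k≤y y≤b ∷ pointwise-≤-bound ks≤ys ys≤b

∸-∸-pred : ∀ n j → j ≤ n → (n ∸ 1) ∸ (n ∸ j) ≡ j ∸ 1
∸-∸-pred n j j≤n = begin
  n ∸ 1 ∸ (n ∸ j)      ≡⟨ NP.∸-+-assoc n 1 (n ∸ j) ⟩
  n ∸ (1 + (n ∸ j))    ≡⟨ cong (n ∸_) (NP.+-comm 1 (n ∸ j)) ⟩
  n ∸ ((n ∸ j) + 1)    ≡⟨ NP.∸-+-assoc n (n ∸ j) 1 ⟨
  n ∸ (n ∸ j) ∸ 1      ≡⟨ cong (_∸ 1) (NP.m∸[m∸n]≡n j≤n) ⟩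
  j ∸ 1                ∎
  where open ≡-Reasoning

-- κ(v) ≤ ρ(v) ≤ label(v), and the labels are distinct and at most n ∸ 1: so at most j ∸ 1 values of κ exceed n ∸ j.
suppBounded⇒labelingABB : ∀ n F → Supp F ⊆[ n ∸ 1 ] → ∀ {κ} → Below κ (rhosF F) → ABBFun n (λ i → count (suc i) κ)
suppBounded⇒labelingABB n F supp {κ} below = beyond , tails
  where
  labels = map label (forestNodes F)
  labels≤ : All (_≤ n ∸ 1) labels
  labels≤ = All.map proj₂ supp
  κ≤labels = below⇒≤labels (forestNodes F) below (forest-rho≤label F 1)
  κ≤ = pointwise-≤-bound κ≤labels labels≤
  beyond : ∀ i → n ≤ i → count (suc i) κ ≡ 0
  beyond i n≤i = count-all-< (suc i) κ (All.map (λ k≤ → s≤s (NP.≤-trans k≤ (NP.≤-trans (NP.m∸n≤m n 1) n≤i))) κ≤)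
  tails : ∀ j → 1 ≤ j → j ≤ n → sumRange (λ i → count (suc i) κ) (n ∸ j) j ≤ j ∸ 1
  tails j _ j≤n = begin
    sumRange (λ i → count (suc i) κ) t j     ≡⟨ sumRange-count κ t j (All.map (λ k≤ → NP.≤-trans k≤ (NP.≤-trans (NP.m∸n≤m n 1) (NP.≤-reflexive (sym (NP.m∸n+n≡m j≤n))))) κ≤) ⟩
    countAbove t κ                           ≤⟨ countAbove-mono t κ≤labels ⟩
    countAbove t labels                      ≤⟨ sorted-length (filterᵇ (t <ᵇ_) labels) (suc t) (n ∸ 1) (AllPairsP.filter⁺ P? (AllPairsP.map⁺ (forestNodes-sorted F))) in-range ⟩
    suc (n ∸ 1) ∸ suc t                      ≡⟨ ∸-∸-pred n j j≤n ⟩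
    j ∸ 1                                    ∎
    where
    open NP.≤-Reasoning
    t = n ∸ j
    P? = T? ∘ (t <ᵇ_)
    in-range : All (λ x → suc t ≤ x × x ≤ n ∸ 1) (filterᵇ (t <ᵇ_) labels)
    in-range = All.zipWith (λ (t<x , x≤) → NP.<ᵇ⇒< t _ t<x , x≤) (AllP.all-filter P? labels , AllP.filter⁺ P? labels≤)

countAbove-++ : ∀ t xs ys → countAbove t (xs ++ ys) ≡ countAbove t xs + countAbove t ys
countAbove-++ t xs ys = trans (cong length (LP.filter-++ (T? ∘ (t <ᵇ_)) xs ys)) (LP.length-++ (filterᵇ (t <ᵇ_) xs))

countAbove-all : ∀ t xs → All (t <_) xs → countAbove t xs ≡ length xs
countAbove-all t xs t<xs = cong length (LP.filter-all (T? ∘ (t <ᵇ_)) (All.map NP.<⇒<ᵇ t<xs))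

length-treeNodes : ∀ T a → length (treeNodes T a) ≡ size T
length-treeNodes leaf a = refl
length-treeNodes (node l r) a = trans (LP.length-++ (treeNodes l a))
  (trans (cong₂ _+_ (length-treeNodes l a) (cong suc (length-treeNodes r _))) (NP.+-suc (size l) (size r)))

Witness : List ℕ → NodeInfo → Set
Witness W u = Σ ℕ λ a → label u < suc a + countAbove a W × 0 < count (suc a) W

Witness-++ˡ : ∀ W W′ {u} → Witness W u → Witness (W ++ W′) u
Witness-++ˡ W W′ (a , label< , occurs) = a ,
  NP.<-≤-trans label< (NP.+-monoʳ-≤ (suc a) (subst (countAbove a W ≤_) (sym (countAbove-++ a W W′)) (NP.m≤m+n _ _))) ,
  NP.<-≤-trans occurs (subst (count (suc a) W ≤_) (sym (count-++ (suc a) W W′)) (NP.m≤m+n _ _))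

Witness-++ʳ : ∀ W′ W {u} → Witness W u → Witness (W′ ++ W) u
Witness-++ʳ W′ W (a , label< , occurs) = a ,
  NP.<-≤-trans label< (NP.+-monoʳ-≤ (suc a) (subst (countAbove a W ≤_) (sym (countAbove-++ a W′ W)) (NP.m≤n+m _ _))) ,
  NP.<-≤-trans occurs (subst (count (suc a) W ≤_) (sym (count-++ (suc a) W′ W)) (NP.m≤n+m _ _))

-- All ρ-values of a tree starting at suc a are ≥ suc a, and suc a itself is one of them.
tree-witness : ∀ l r a → All (Witness (rhos (treeNodes (node l r) (suc a)))) (treeNodes (node l r) (suc a))
tree-witness l r a = All.map (λ (_ , label<) → a , subst (λ s → _ < suc a + s) (sym all-above) label< , occurs)
  (proj₁ (tree-labels (node l r) (suc a)))
  where
  all-above : countAbove a (rhos (treeNodes (node l r) (suc a))) ≡ size (node l r)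
  all-above = trans (countAbove-all a _ (rhos-tree-≥ (node l r) (suc a)))
    (trans (LP.length-map rho (treeNodes (node l r) (suc a))) (length-treeNodes (node l r) (suc a)))
  occurs : 0 < count (suc a) (rhos (treeNodes (node l r) (suc a)))
  occurs rewrite rhos-node l r (suc a) = count-middle (suc a) (rhos (treeNodes l (suc a))) _

forest-witness : ∀ F next → All (Witness (rhos (forestNodes' (suc next) F))) (forestNodes' (suc next) F)
forest-witness [] next = []
forest-witness (blk g l r ∷ bs) next rewrite rhos-++ (treeNodes (node l r) (suc (next + g))) (forestNodes' (suc (next + g + size (node l r) + 1)) bs) =
  AllP.++⁺ (All.map (λ {u} → Witness-++ˡ tree-rhos rest-rhos {u}) (tree-witness l r (next + g)))
           (All.map (λ {u} → Witness-++ʳ tree-rhos rest-rhos {u}) (forest-witness bs _))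
  where
  tree-rhos = rhos (treeNodes (node l r) (suc (next + g)))
  rest-rhos = rhos (forestNodes' (suc (next + g + size (node l r) + 1)) bs)

<⇒≤∸1 : ∀ {x n} → x < n → x ≤ n ∸ 1
<⇒≤∸1 {n = suc n} (s≤s x≤n) = x≤n

-- A witness value a + 1 occurs, so a < n, and then the ABB bound for j = n ∸ a gives label < n.
ABBFun⇒suppBounded : ∀ n F → ABBFun n (λ i → count (suc i) (rhosF F)) → Supp F ⊆[ n ∸ 1 ]
ABBFun⇒suppBounded n F (beyond , tails) = AllP.map⁺
  (All.zipWith (λ {u} (1≤label , witness) → 1≤label , label≤ {u} witness) (proj₁ (forest-labels F 1) , forest-witness F 0))
  where
  ρ = rhosF F
  ρ≤n : All (_≤ n) ρ
  ρ≤n = count-above⇒all≤ ρ n (rhosF-pos F) beyond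
  label≤ : ∀ {u} → Witness ρ u → label u ≤ n ∸ 1
  label≤ {u} (a , label< , occurs) = <⇒≤∸1 (NP.<-≤-trans label< (NP.≤-trans (NP.+-monoʳ-≤ (suc a) above≤) (NP.≤-reflexive a+j∸1≡n)))
    where
    a<n : a < n
    a<n with a ℕ.<? n
    ... | yes a<n = a<n
    ... | no a≮n = ⊥-elim (NP.<-irrefl (sym (beyond a (NP.≮⇒≥ a≮n))) occurs)
    j = n ∸ a
    above≤ : countAbove a ρ ≤ j ∸ 1
    above≤ = subst (_≤ j ∸ 1)
      (trans (cong (λ t → sumRange (λ i → count (suc i) ρ) t j) (NP.m∸[m∸n]≡n (NP.<⇒≤ a<n)))
             (sumRange-count ρ a j (All.map (λ x≤n → NP.≤-trans x≤n (NP.≤-reflexive (sym (NP.m+[n∸m]≡n (NP.<⇒≤ a<n))))) ρ≤n)))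
      (tails j (NP.m<n⇒0<n∸m a<n) (NP.m∸n≤m n a))
    a+j∸1≡n : suc a + (j ∸ 1) ≡ n
    a+j∸1≡n = trans (cong (suc a +_) (trans (NP.∸-+-assoc n a 1) (cong (n ∸_) (NP.+-comm a 1)))) (NP.m+[n∸m]≡n a<n)

module _ (n : ℕ) where

  countVec : List ℕ → Vec ℕ n
  countVec κ = vecOf n (λ i → count (suc i) κ)

  countVec≋monOf : ∀ κ → ABBFun n (λ i → count (suc i) κ) → toList (countVec κ) ≋ monOf κ
  countVec≋monOf κ (beyond , _) i = trans (expAt-vecOf n _ beyond i) (sym (expAt-monOf κ i))

  forestPoly∈span-ABB : ∀ F → Supp F ⊆[ n ∸ 1 ] → InSpan (monoP {n}) (ABB n) (forestPoly F)
  forestPoly∈span-ABB F supp = InSpan-poly {f = monoP} {Q = ABB n} (termsOf (labelings F)) (AllP.map⁺ (All.map (λ {κ} → monomial∈ {κ}) (labelings-below F)))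
    where
    monomial∈ : ∀ {κ} → Below κ (rhosF F) → InSpan (monoP {n}) (ABB n) ((1ℚ , monOf κ) ∷ [])
    monomial∈ {κ} below = InSpan-resp monoP ((1ℚ , monOf κ) ∷ []) (monoP (countVec κ)) same
      (InSpan-member {f = monoP} {i = countVec κ} (ABBFun⇒ABB n (countVec κ) (ABBFun-cong (λ i → sym (expAt-vecOf n (λ i → count (suc i) κ) (proj₁ abb) i)) abb)))
      where
      abb = suppBounded⇒labelingABB n F supp below
      same : ((1ℚ , monOf κ) ∷ []) ≈ₚ monoP (countVec κ)
      same m = trans (coeff-monomial (monOf κ) m) (trans (cong indicator (monEq-congˡ (monOf κ) (toList (countVec κ)) m
        (λ i → sym (countVec≋monOf κ abb i)))) (sym (coeff-monomial (toList (countVec κ)) m)))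

  decode-ABB : ∀ m → ABBFun n (expAt m) →
    Supp (decode m) ⊆[ n ∸ 1 ] × All (ABBFun n ∘ expAt ∘ monOf) (labelings (decode m))
  decode-ABB m abb = supp , All.map (λ {κ} below → ABBFun-cong (λ i → sym (expAt-monOf κ i)) (suppBounded⇒labelingABB n F supp below))
    (labelings-below F)
    where
    F = decode m
    supp = ABBFun⇒suppBounded n F (ABBFun-cong (λ i → sym (count-rhos-decode m i)) abb)

  span-ABB : ∀ p → InSpan forestPoly (λ F → Supp F ⊆[ n ∸ 1 ]) p ⇔ InSpan (monoP {n}) (ABB n) p
  span-ABB p = mk⇔ (InSpan-trans {f = forestPoly} {g = monoP} forestPoly∈span-ABB p)
    (InSpan-trans {f = monoP} {g = forestPoly} (λ c abb → Spanning.span-monomial _ (ABBFun n ∘ expAt) decode-ABB (toList c) (ABB⇒ABBFun n c abb)) p)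

proposition3p6 : IsBasisOf forestPoly (λ _ → ⊤) (λ _ → ⊤)
    × (∀ (n : ℕ) → 1 ≤ n →
         IsBasisOf forestPoly (λ F → LSupp F ⊆[ n ]) (InVars n))
    × (∀ (n : ℕ) → 1 ≤ n → ∀ (p : Poly) →
         InSpan forestPoly (λ F → Supp F ⊆[ n ∸ 1 ]) p
           ⇔ InSpan (monoP {n}) (ABB n) p)
proposition3p6 = basis , (λ n _ → basis-inVars n) , (λ n _ → span-ABB n)
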